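{- Let $\mathfrak g\ge1$, $r\ge0$, integers $1<m_1\le\dots\le m_r$, and let $\Gamma$ be the group with generators $x_1,\dots,x_r,a_1,\dots,a_{\mathfrak g}$ and relations $\prod_i x_i\prod_k a_k^2=1$, $x_i^{m_i}=1$. Let $m=\mathrm{lcm}(m_1,\dots,m_r)$, let $b$ be the denominator of the reduced fraction $\sum_{i=1}^r\frac{1}{2m_i}$, and let $m'=\mathrm{lcm}(2,b,m_1,\dots,m_r)$. Then: (i) if $l$ is odd, $\mathrm{Epi}_o(\Gamma,\mathbb{Z}_l)=m^{\mathfrak g-1}J_{\mathfrak g-1}(l/m)\prod_{i=1}^r\phi(m_i)$; (ii) if $l=2^qk$ with $k$ odd and $q>1$, $\mathrm{Epi}_o(\Gamma,\mathbb{Z}_l)=2(m')^{\mathfrak g-1}J_{\mathfrak g-1}(l/m')\prod_{i=1}^r\phi(m_i)$; (iii) if $l=2k$ with $k$ odd, $\mathrm{Epi}_o(\Gamma,\mathbb{Z}_l)=2(m')^{\mathfrak g-1}J_{\mathfrak g-1}(l/m')\prod_{i=1}^r\phi(m_i)-m^{\mathfrak g-1}J_{\mathfrak g-1}\bigl(\tfrac{l}{2m}\bigr)\prod_{i=1}^r\phi(m_i)$.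
   Context: $\mathrm{Epi}_o(\Gamma,\mathbb{Z}_l)$ is the number of surjective homomorphisms $\psi:\Gamma\to\mathbb{Z}_l$ with $\psi(x_i)$ of order exactly $m_i$ for every $i$. $J_k(n)=\sum_{d\mid n}\mu(n/d)d^k$ is Jordan's totient function (so $J_0(1)=1$, $J_0(n)=0$ for $n>1$), and any term $J_k(x)$ with $x$ not an integer is taken to be $0$. $\phi$ is Euler's totient, $\mu$ the Möbius function; the lcm of an empty list is $1$ and an empty sum is $0$ (with denominator $1$). -}

module Defs where

open import Data.Bool using (Bool; true; false; if_then_else_; _∧_)
open import Data.Nat as ℕ using (ℕ; zero; suc; _≤_; _<_; _∸_; NonZero; _≡ᵇ_)
open import Data.Nat.Divisibility using (_∣_; _∣?_)
open import Data.Nat.DivMod using (_%_; _/_)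
open import Data.Nat.GCD using (gcd)
open import Data.Nat.LCM using (lcm)
open import Data.Nat.Primality using (prime?)
open import Data.Fin using (Fin; toℕ)
import Data.Fin.Properties as FinP
open import Data.Nat.ListAction as NL using ()
open import Data.Bool.ListAction as BL using ()
open import Data.List as List using (List; []; _∷_; upTo; allFin; filterᵇ; length; foldr)
open import Data.Vec as Vec using (Vec; []; _∷_; lookup; toList; zipWith)
open import Data.Integer as ℤ using (ℤ; +_; -_)
open import Data.Rational as ℚ using (ℚ)
open import Data.Product using (∃; _×_; _,_)
open import Relation.Nullary using (Dec; yes; no; ¬_; does; _×-dec_; ¬?; _→-dec_)
open import Relation.Nullary.Decidable using (map′)
open import Relation.Unary using (Decidable)
open import Relation.Binary.PropositionalEquality using (_≡_)

lcmList : List ℕ → ℕ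
lcmList = foldr lcm 1

φ : ℕ → ℕ
φ n = length (filterᵇ (λ a → gcd a n ≡ᵇ 1) (List.map suc (upTo n)))

primesUpTo : ℕ → List ℕ
primesUpTo n = filterᵇ (λ p → does (prime? p)) (upTo (suc n))

μ : ℕ → ℤ
μ n = if BL.any (λ p → does ((p ℕ.* p) ∣? n)) (primesUpTo n)
      then + 0
      else (ℤ.-1ℤ) ℤ.^ length (filterᵇ (λ p → does (p ∣? n)) (primesUpTo n))

sumℤ : List ℤ → ℤ
sumℤ = foldr ℤ._+_ (+ 0)

Jordan : ℕ → ℕ → ℤ
Jordan k n = sumℤ (List.map term (upTo n))
  where
  term : ℕ → ℤ
  term j = if does (suc j ∣? n) then μ (n / suc j) ℤ.* (+ (suc j ℕ.^ k)) else + 0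

-- J_k(a / b): taken to be 0 when a / b is not an integer (and when b = 0)
Jfrac : ℕ → ℕ → ℕ → ℤ
Jfrac k a zero = + 0
Jfrac k a (suc b) = if does (suc b ∣? a) then Jordan k (a / suc b) else + 0

-- 1 / (2 m) as a rational (m = 0 never occurs below since m_i > 1)
inv2 : ℕ → ℚ
inv2 zero = ℚ.0ℚ
inv2 (suc m) = + 1 ℚ./ (2 ℕ.* suc m)

-- Counting over Z_l (elements of Z_l represented by Fin l)

sumVec : (l n : ℕ) → (Vec (Fin l) n → ℕ) → ℕ
sumVec l zero f = f []
sumVec l (suc n) f = NL.sum (List.map (λ x → sumVec l n (λ v → f (x ∷ v))) (allFin l))

indicator : ∀ {p} {P : Set p} → Dec P → ℕ
indicator d = if does d then 1 else 0

anyVec? : (l n : ℕ) {P : Vec (Fin l) n → Set} → Decidable P → Dec (∃ λ v → P v)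
anyVec? l zero P? = map′ (λ p → [] , p) (λ { ([] , p) → p }) (P? [])
anyVec? l (suc n) P? =
  map′ (λ { (x , v , p) → x ∷ v , p }) (λ { (x ∷ v , p) → x , v , p })
       (FinP.any? (λ x → anyVec? l n (λ v → P? (x ∷ v))))

vsum : ∀ {l n} → Vec (Fin l) n → ℕ
vsum v = Vec.sum (Vec.map toℕ v)

lin : ∀ {l n} → Vec (Fin l) n → Vec (Fin l) n → ℕ
lin c v = Vec.sum (zipWith (λ a b → toℕ a ℕ.* toℕ b) c v)

-- A homomorphism ψ is determined by y_i = ψ(x_i), z_k = ψ(a_k) ∈ Z_l subject to the
-- relations (written additively in Z_l).

module _ (l : ℕ) .{{_ : NonZero l}} {r g : ℕ} (ms : Vec ℕ r) where

  IsHom : Vec (Fin l) r → Vec (Fin l) g → Set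
  IsHom y z = (l ∣ (vsum y ℕ.+ 2 ℕ.* vsum z))
            × (∀ (i : Fin r) → l ∣ (lookup ms i ℕ.* toℕ (lookup y i)))

  HasOrder : Fin l → ℕ → Set
  HasOrder y m = (1 ≤ m) × (l ∣ (m ℕ.* toℕ y))
               × (∀ (d : Fin m) → 1 ≤ toℕ d → ¬ (l ∣ (toℕ d ℕ.* toℕ y)))

  -- ψ is onto: every t ∈ Z_l is an integer combination of the images of the
  -- generators (coefficients may be taken in Z_l)
  Surjective : Vec (Fin l) r → Vec (Fin l) g → Set
  Surjective y z = ∀ (t : Fin l) → ∃ λ (c : Vec (Fin l) r) → ∃ λ (e : Vec (Fin l) g) →
                     (lin c y ℕ.+ lin e z) % l ≡ toℕ t

  IsEpiO : Vec (Fin l) r → Vec (Fin l) g → Set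
  IsEpiO y z = IsHom y z × Surjective y z × (∀ (i : Fin r) → HasOrder (lookup y i) (lookup ms i))

  hasOrder? : ∀ y m → Dec (HasOrder y m)
  hasOrder? y m = (1 ℕ.≤? m) ×-dec (l ∣? (m ℕ.* toℕ y))
                  ×-dec FinP.all? (λ d → (1 ℕ.≤? toℕ d) →-dec (¬? (l ∣? (toℕ d ℕ.* toℕ y))))

  isEpiO? : ∀ y z → Dec (IsEpiO y z)
  isEpiO? y z =
    ((l ∣? (vsum y ℕ.+ 2 ℕ.* vsum z)) ×-dec FinP.all? (λ i → l ∣? (lookup ms i ℕ.* toℕ (lookup y i))))
    ×-dec FinP.all? (λ t → anyVec? l r (λ c → anyVec? l g (λ e → (lin c y ℕ.+ lin e z) % l ℕ.≟ toℕ t)))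
    ×-dec FinP.all? (λ i → hasOrder? (lookup y i) (lookup ms i))

  EpiO' : ℕ
  EpiO' = sumVec l r (λ y → sumVec l g (λ z → indicator (isEpiO? y z)))

-- Epi_o(Γ, Z_l) for Γ with genus g and periods ms; (Z_0 is not considered: value 0)
EpiO : (g : ℕ) {r : ℕ} → Vec ℕ r → ℕ → ℕ
EpiO g ms zero = 0
EpiO g ms (suc l) = EpiO' (suc l) {g = g} ms

module _ {r : ℕ} (ms : Vec ℕ r) where
  mOf : ℕ
  mOf = lcmList (toList ms)

  bOf : ℕ
  bOf = ℚ.ℚ.denominatorℕ (foldr ℚ._+_ ℚ.0ℚ (List.map inv2 (toList ms)))

  m'Of : ℕ
  m'Of = lcmList (2 ∷ bOf ∷ toList ms)

  prodφ : ℕ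
  prodφ = NL.product (List.map φ (toList ms))

{-# OPTIONS --safe #-}

-- A homomorphism Γ → ℤ_l is a pair (y, z) ∈ ℤ_l^r × ℤ_l^g with Σ y + 2 Σ z = 0; it is counted when
-- each y_i has order m_i and it is onto, i.e. gcd(y, z, l) = 1. Möbius inversion over that gcd gives
-- Epi_o = Σ_{e ∣ l} μ(e) H(l / e), where H(n) counts the pairs inside e ℤ_l ≅ ℤ_n. The count H(n)
-- factors: the y_i contribute Π_i [m_i ∣ n] φ(m_i); for fixed y the relation leaves n^(g-1) choices of
-- z times the number of w ∈ ℤ_n with c + 2 w = 0, which is 1 for odd n and, for even n, 2 or 0 according
-- to the parity of c ≡ Σ_i n / m_i. As Σ_i 1 / (2 m_i) = (Σ_i n / m_i) / (2 n), that sum is even exactly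
-- when b ∣ n, i.e. m′ ∣ n. Hence H(n) = Π_i φ(m_i) n^(g-1) ([n odd] [m ∣ n] + 2 [m′ ∣ n]), and
-- Σ_{d ∣ l, M ∣ d} μ(l / d) d^k = M^k J_k(l / M) gives the three cases: for odd l only the first term
-- survives, for 4 ∣ l the odd divisors d have μ(l / d) = 0, and for l = 2 k the odd divisors of l are
-- those of k, with μ(2 k / d) = - μ(k / d).

module Submission where

open import Algebra.Core using (Op₂)
open import Algebra.Structures using (IsCommutativeSemiring)
open import Data.Bool using (Bool; true; false; _∧_; _∨_; not; if_then_else_; T)
import Data.Bool.ListAction as BL
import Data.Bool.Properties as 𝔹P
open import Data.Empty using (⊥; ⊥-elim)
open import Data.Fin as Fin using (Fin; toℕ)
import Data.Fin.Properties as FinP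
open import Data.Integer as ℤ using (ℤ; +_)
import Data.Integer.GCD as ℤGCD
import Data.Integer.Properties as ℤP
import Data.Integer.Tactic.RingSolver as ℤSolver
open import Data.List as List using (List; []; _∷_; foldr; applyUpTo; upTo; allFin; filterᵇ; length)
import Data.List.Properties as ListP
open import Data.List.Relation.Unary.All using (_∷_)
open import Data.Nat as ℕ using (ℕ; zero; suc; _+_; _*_; _^_; _∸_; _≤_; _<_; z≤n; s≤s; NonZero; _≟_)
open import Data.Nat.Coprimality using (Coprime; coprime-divisor; recompute) renaming (sym to coprime-sym)
open import Data.Nat.Divisibility
open import Data.Nat.DivMod
  using (_%_; _/_; m*n/n≡m; %-distribˡ-+; %-distribˡ-*; m%n%n≡m%n; [m+kn]%n≡m%n; m<n⇒m%n≡m; m%n<n; m*n%n≡0; m≡m%n+[m/n]*n)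
open import Data.Nat.GCD
  using (gcd; gcd[m,n]∣m; gcd[m,n]∣n; gcd-greatest; c*gcd[m,n]≡gcd[cm,cn]; gcd[m,n]≢0; gcd-GCD; gcd-identityˡ; module Bézout)
open import Data.Nat.LCM using (lcm; m∣lcm[m,n]; n∣lcm[m,n]; lcm-least; gcd*lcm)
open import Data.Nat.Primality
  using (Prime; prime?; prime[2]; euclidsLemma; prime⇒irreducible; prime⇒nonZero; prime⇒nonTrivial)
open import Data.Nat.Primality.Factorisation using (factorise)
import Data.Nat.Properties as ℕP
open import Data.Nat.Tactic.RingSolver using (solve-∀)
open import Data.Product using (_×_; _,_; ∃; ∃₂; proj₁; proj₂)
open import Data.Rational as ℚ using (ℚ; mkℚ; ↥_; ↧_; ↧ₙ_)
import Data.Rational.Properties as ℚP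
open import Data.Sum using (inj₁; inj₂)
open import Data.Unit using (⊤; tt)
open import Data.Vec using (Vec; []; _∷_; lookup; toList)
open import Function using (_∘_; _⇔_; mk⇔; Equivalence)
open import Relation.Binary.Definitions using (tri<; tri≈; tri>)
open import Relation.Binary.PropositionalEquality
open import Relation.Nullary using (Dec; yes; no; ¬_; does; _×-dec_)
open import Relation.Nullary.Decidable using (dec-true; dec-false; does-⇔; T?)

open import Defs

-- Finite sums

module FiniteSums {A : Set} {_⊕_ _⊗_ : Op₂ A} {ε 1# : A}
                  (isCommutativeSemiring : IsCommutativeSemiring _≡_ _⊕_ _⊗_ ε 1#) where

  open IsCommutativeSemiring isCommutativeSemiring
    using (+-assoc; +-comm; +-identityˡ; +-identityʳ; *-comm; distribˡ; zeroʳ)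

  ⊕-interchange : ∀ a b c d → (a ⊕ b) ⊕ (c ⊕ d) ≡ (a ⊕ c) ⊕ (b ⊕ d)
  ⊕-interchange a b c d = begin
    (a ⊕ b) ⊕ (c ⊕ d) ≡⟨ +-assoc a b (c ⊕ d) ⟩
    a ⊕ (b ⊕ (c ⊕ d)) ≡⟨ cong (a ⊕_) (sym (+-assoc b c d)) ⟩
    a ⊕ ((b ⊕ c) ⊕ d) ≡⟨ cong (λ t → a ⊕ (t ⊕ d)) (+-comm b c) ⟩
    a ⊕ ((c ⊕ b) ⊕ d) ≡⟨ cong (a ⊕_) (+-assoc c b d) ⟩
    a ⊕ (c ⊕ (b ⊕ d)) ≡⟨ sym (+-assoc a c (b ⊕ d)) ⟩
    (a ⊕ c) ⊕ (b ⊕ d) ∎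
    where open ≡-Reasoning

  𝟙 : Bool → A
  𝟙 b = if b then 1# else ε

  when : Bool → A → A
  when b a = if b then a else ε

  when-ε : ∀ b → when b ε ≡ ε
  when-ε true  = refl
  when-ε false = refl

  when-∧ : ∀ a b x → when (a ∧ b) x ≡ when a (when b x)
  when-∧ true  b x = refl
  when-∧ false b x = refl

  when-comm : ∀ a b x → when a (when b x) ≡ when b (when a x)
  when-comm true  b x = refl
  when-comm false b x = sym (when-ε b)

  when-not : ∀ b a → when b a ⊕ when (not b) a ≡ a
  when-not true  a = +-identityʳ a
  when-not false a = +-identityˡ a

  ∑ : ℕ → (ℕ → A) → A
  ∑ zero    f = ε
  ∑ (suc n) f = f 0 ⊕ ∑ n (f ∘ suc)

  ∑-cong : ∀ n {f g : ℕ → A} → (∀ j → j < n → f j ≡ g j) → ∑ n f ≡ ∑ n g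
  ∑-cong zero    f≡g = refl
  ∑-cong (suc n) f≡g = cong₂ _⊕_ (f≡g 0 (s≤s z≤n)) (∑-cong n (λ j j<n → f≡g (suc j) (s≤s j<n)))

  ∑-zero : ∀ n {f : ℕ → A} → (∀ j → j < n → f j ≡ ε) → ∑ n f ≡ ε
  ∑-zero zero    f≡ε = refl
  ∑-zero (suc n) f≡ε =
    trans (cong₂ _⊕_ (f≡ε 0 (s≤s z≤n)) (∑-zero n (λ j j<n → f≡ε (suc j) (s≤s j<n)))) (+-identityˡ ε)

  ∑-distrib-⊕ : ∀ n (f g : ℕ → A) → ∑ n (λ j → f j ⊕ g j) ≡ ∑ n f ⊕ ∑ n g
  ∑-distrib-⊕ zero    f g = sym (+-identityˡ ε)
  ∑-distrib-⊕ (suc n) f g =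
    trans (cong ((f 0 ⊕ g 0) ⊕_) (∑-distrib-⊕ n (f ∘ suc) (g ∘ suc))) (⊕-interchange _ _ _ _)

  ∑-distribˡ-⊗ : ∀ n c (f : ℕ → A) → ∑ n (λ j → c ⊗ f j) ≡ c ⊗ ∑ n f
  ∑-distribˡ-⊗ zero    c f = sym (zeroʳ c)
  ∑-distribˡ-⊗ (suc n) c f = trans (cong ((c ⊗ f 0) ⊕_) (∑-distribˡ-⊗ n c (f ∘ suc))) (sym (distribˡ c _ _))

  ∑-distribʳ-⊗ : ∀ n (f : ℕ → A) c → ∑ n (λ j → f j ⊗ c) ≡ ∑ n f ⊗ c
  ∑-distribʳ-⊗ n f c = trans (∑-cong n (λ j _ → *-comm (f j) c)) (trans (∑-distribˡ-⊗ n c f) (*-comm c _))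

  ∑-split : ∀ a b (f : ℕ → A) → ∑ (a + b) f ≡ ∑ a f ⊕ ∑ b (λ j → f (a + j))
  ∑-split zero    b f = sym (+-identityˡ _)
  ∑-split (suc a) b f = trans (cong (f 0 ⊕_) (∑-split a b (f ∘ suc))) (sym (+-assoc _ _ _))

  ∑-last : ∀ n (f : ℕ → A) → ∑ (suc n) f ≡ ∑ n f ⊕ f n
  ∑-last n f = begin
    ∑ (suc n) f                   ≡⟨ cong (λ k → ∑ k f) (ℕP.+-comm 1 n) ⟩
    ∑ (n + 1) f                   ≡⟨ ∑-split n 1 f ⟩
    ∑ n f ⊕ (f (n + 0) ⊕ ε)       ≡⟨ cong (∑ n f ⊕_) (trans (+-identityʳ _) (cong f (ℕP.+-identityʳ n))) ⟩
    ∑ n f ⊕ f n                   ∎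
    where open ≡-Reasoning

  ∑-extend : ∀ n k (f : ℕ → A) → n ≤ k → (∀ j → n ≤ j → j < k → f j ≡ ε) → ∑ k f ≡ ∑ n f
  ∑-extend n k f n≤k f≡ε = begin
    ∑ k f                                   ≡⟨ cong (λ i → ∑ i f) (sym (ℕP.m+[n∸m]≡n n≤k)) ⟩
    ∑ (n + (k ∸ n)) f                       ≡⟨ ∑-split n (k ∸ n) f ⟩
    ∑ n f ⊕ ∑ (k ∸ n) (λ j → f (n + j))     ≡⟨ cong (∑ n f ⊕_) (∑-zero (k ∸ n) tail≡ε) ⟩
    ∑ n f ⊕ ε                               ≡⟨ +-identityʳ _ ⟩
    ∑ n f                                   ∎
    where
    open ≡-Reasoning
    tail≡ε : ∀ j → j < k ∸ n → f (n + j) ≡ ε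
    tail≡ε j j< = f≡ε (n + j) (ℕP.m≤m+n n j)
                      (subst (n + j <_) (ℕP.m+[n∸m]≡n n≤k) (ℕP.+-monoʳ-< n j<))

  ∑-single : ∀ n (f : ℕ → A) b → b < n → (∀ j → j < n → j ≢ b → f j ≡ ε) → ∑ n f ≡ f b
  ∑-single (suc n) f zero b<n others≡ε =
    trans (cong (f 0 ⊕_) (∑-zero n (λ j j<n → others≡ε (suc j) (s≤s j<n) (λ ())))) (+-identityʳ _)
  ∑-single (suc n) f (suc b) (s≤s b<n) others≡ε =
    trans (cong₂ _⊕_ (others≡ε 0 (s≤s z≤n) (λ ()))
                     (∑-single n (f ∘ suc) b b<n
                        (λ j j<n j≢b → others≡ε (suc j) (s≤s j<n) (j≢b ∘ ℕP.suc-injective))))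
          (+-identityˡ _)

  ∑-comm : ∀ n m (f : ℕ → ℕ → A) → ∑ n (λ i → ∑ m (f i)) ≡ ∑ m (λ j → ∑ n (λ i → f i j))
  ∑-comm zero    m f = sym (∑-zero m (λ _ _ → refl))
  ∑-comm (suc n) m f = trans (cong (∑ m (f 0) ⊕_) (∑-comm n m (f ∘ suc)))
                             (sym (∑-distrib-⊕ m (f 0) (λ j → ∑ n (λ i → f (suc i) j))))

  ∑-multiples : ∀ e n (f : ℕ → A) → .{{NonZero e}} →
                ∑ (e * n) (λ x → when (does (e ∣? x)) (f x)) ≡ ∑ n (λ w → f (e * w))
  ∑-multiples e zero    f = cong (λ k → ∑ k (λ x → when (does (e ∣? x)) (f x))) (ℕP.*-zeroʳ e)
  ∑-multiples e (suc n) f = begin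
    ∑ (e * suc n) g                        ≡⟨ cong (λ k → ∑ k g) (trans (ℕP.*-suc e n) (ℕP.+-comm e (e * n))) ⟩
    ∑ (e * n + e) g                        ≡⟨ ∑-split (e * n) e g ⟩
    ∑ (e * n) g ⊕ ∑ e (λ j → g (e * n + j)) ≡⟨ cong₂ _⊕_ (∑-multiples e n f) block ⟩
    ∑ n (λ w → f (e * w)) ⊕ f (e * n)      ≡⟨ sym (∑-last n (λ w → f (e * w))) ⟩
    ∑ (suc n) (λ w → f (e * w))            ∎
    where
    open ≡-Reasoning
    g = λ x → when (does (e ∣? x)) (f x)
    e∤en+j : ∀ j → j < e → j ≢ 0 → ¬ e ∣ e * n + j
    e∤en+j zero    _   j≢0 _ = j≢0 refl
    e∤en+j (suc j) j<e _   d = ℕP.<⇒≱ j<e (∣⇒≤ (∣m+n∣m⇒∣n d (m∣m*n n)))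
    block : ∑ e (λ j → g (e * n + j)) ≡ f (e * n)
    block = begin
      ∑ e (λ j → g (e * n + j))
        ≡⟨ ∑-single e _ 0 (ℕ.>-nonZero⁻¹ e)
             (λ j j<e j≢0 → cong (λ b → when b (f (e * n + j))) (dec-false (e ∣? _) (e∤en+j j j<e j≢0))) ⟩
      g (e * n + 0)
        ≡⟨ cong g (ℕP.+-identityʳ _) ⟩
      g (e * n)
        ≡⟨ cong (λ b → when b (f (e * n))) (dec-true (e ∣? _) (m∣m*n n)) ⟩
      f (e * n) ∎

  ∑ˡ : List A → A
  ∑ˡ = foldr _⊕_ ε

  ∑ˡ-applyUpTo : ∀ n (h : ℕ → A) (g : ℕ → ℕ) → ∑ˡ (List.map h (applyUpTo g n)) ≡ ∑ n (h ∘ g)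
  ∑ˡ-applyUpTo zero    h g = refl
  ∑ˡ-applyUpTo (suc n) h g = cong (h (g 0) ⊕_) (∑ˡ-applyUpTo n h (g ∘ suc))

  ∑ˡ-upTo : ∀ n (h : ℕ → A) → ∑ˡ (List.map h (upTo n)) ≡ ∑ n h
  ∑ˡ-upTo n h = ∑ˡ-applyUpTo n h (λ x → x)

  ∑ˡ-tabulate : ∀ n {B : Set} (f : Fin n → B) (h : B → A) (h′ : ℕ → A) → (∀ i → h (f i) ≡ h′ (toℕ i)) →
                ∑ˡ (List.map h (List.tabulate f)) ≡ ∑ n h′
  ∑ˡ-tabulate zero    f h h′ hf≡h′ = refl
  ∑ˡ-tabulate (suc n) f h h′ hf≡h′ =
    cong₂ _⊕_ (hf≡h′ Fin.zero) (∑ˡ-tabulate n (f ∘ Fin.suc) h (h′ ∘ suc) (hf≡h′ ∘ Fin.suc))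

  ∑ˡ-allFin : ∀ n (h : Fin n → A) (h′ : ℕ → A) → (∀ i → h i ≡ h′ (toℕ i)) →
              ∑ˡ (List.map h (allFin n)) ≡ ∑ n h′
  ∑ˡ-allFin n = ∑ˡ-tabulate n (λ i → i)

  ∑ˡ-map-cong : ∀ {B : Set} (xs : List B) {f g : B → A} → (∀ x → f x ≡ g x) →
                ∑ˡ (List.map f xs) ≡ ∑ˡ (List.map g xs)
  ∑ˡ-map-cong []       f≡g = refl
  ∑ˡ-map-cong (x ∷ xs) f≡g = cong₂ _⊕_ (f≡g x) (∑ˡ-map-cong xs f≡g)

  ∑ˡ-distrib-⊕ : ∀ {B : Set} (xs : List B) (f g : B → A) →
                 ∑ˡ (List.map (λ x → f x ⊕ g x) xs) ≡ ∑ˡ (List.map f xs) ⊕ ∑ˡ (List.map g xs)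
  ∑ˡ-distrib-⊕ []       f g = sym (+-identityˡ ε)
  ∑ˡ-distrib-⊕ (x ∷ xs) f g = trans (cong ((f x ⊕ g x) ⊕_) (∑ˡ-distrib-⊕ xs f g)) (⊕-interchange _ _ _ _)

  ∑ˡ-distribˡ-⊗ : ∀ {B : Set} (xs : List B) c (f : B → A) →
                  ∑ˡ (List.map (λ x → c ⊗ f x) xs) ≡ c ⊗ ∑ˡ (List.map f xs)
  ∑ˡ-distribˡ-⊗ []       c f = sym (zeroʳ c)
  ∑ˡ-distribˡ-⊗ (x ∷ xs) c f = trans (cong ((c ⊗ f x) ⊕_) (∑ˡ-distribˡ-⊗ xs c f)) (sym (distribˡ c _ _))

  ∑ˡ-zero : ∀ {B : Set} (xs : List B) → ∑ˡ (List.map (λ _ → ε) xs) ≡ ε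
  ∑ˡ-zero []       = refl
  ∑ˡ-zero (x ∷ xs) = trans (cong (ε ⊕_) (∑ˡ-zero xs)) (+-identityˡ ε)

  -- sumVec, over an arbitrary semiring
  ∑ᵛ : (l n : ℕ) → (Vec (Fin l) n → A) → A
  ∑ᵛ l zero    f = f []
  ∑ᵛ l (suc n) f = ∑ˡ (List.map (λ x → ∑ᵛ l n (λ v → f (x ∷ v))) (allFin l))

  ∑ᵛ-cong : ∀ l n {f g : Vec (Fin l) n → A} → (∀ v → f v ≡ g v) → ∑ᵛ l n f ≡ ∑ᵛ l n g
  ∑ᵛ-cong l zero    f≡g = f≡g []
  ∑ᵛ-cong l (suc n) f≡g = ∑ˡ-map-cong (allFin l) (λ x → ∑ᵛ-cong l n (λ v → f≡g (x ∷ v)))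

  ∑ᵛ-distrib-⊕ : ∀ l n (f g : Vec (Fin l) n → A) → ∑ᵛ l n (λ v → f v ⊕ g v) ≡ ∑ᵛ l n f ⊕ ∑ᵛ l n g
  ∑ᵛ-distrib-⊕ l zero    f g = refl
  ∑ᵛ-distrib-⊕ l (suc n) f g =
    trans (∑ˡ-map-cong (allFin l) (λ x → ∑ᵛ-distrib-⊕ l n (λ v → f (x ∷ v)) (λ v → g (x ∷ v))))
          (∑ˡ-distrib-⊕ (allFin l) _ _)

  ∑ᵛ-distribˡ-⊗ : ∀ l n c (f : Vec (Fin l) n → A) → ∑ᵛ l n (λ v → c ⊗ f v) ≡ c ⊗ ∑ᵛ l n f
  ∑ᵛ-distribˡ-⊗ l zero    c f = refl
  ∑ᵛ-distribˡ-⊗ l (suc n) c f =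
    trans (∑ˡ-map-cong (allFin l) (λ x → ∑ᵛ-distribˡ-⊗ l n c (λ v → f (x ∷ v))))
          (∑ˡ-distribˡ-⊗ (allFin l) c _)

  ∑ᵛ-zero : ∀ l n → ∑ᵛ l n (λ _ → ε) ≡ ε
  ∑ᵛ-zero l zero    = refl
  ∑ᵛ-zero l (suc n) = trans (∑ˡ-map-cong (allFin l) (λ _ → ∑ᵛ-zero l n)) (∑ˡ-zero (allFin l))

  ∑ᵛ-when : ∀ l n b (f : Vec (Fin l) n → A) → ∑ᵛ l n (λ v → when b (f v)) ≡ when b (∑ᵛ l n f)
  ∑ᵛ-when l n true  f = refl
  ∑ᵛ-when l n false f = ∑ᵛ-zero l n

  ∑ᵛ-∑ : ∀ l n k (f : ℕ → Vec (Fin l) n → A) → ∑ᵛ l n (λ v → ∑ k (λ j → f j v)) ≡ ∑ k (λ j → ∑ᵛ l n (f j))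
  ∑ᵛ-∑ l n zero    f = ∑ᵛ-zero l n
  ∑ᵛ-∑ l n (suc k) f = trans (∑ᵛ-distrib-⊕ l n (f 0) (λ v → ∑ k (λ j → f (suc j) v)))
                             (cong (∑ᵛ l n (f 0) ⊕_) (∑ᵛ-∑ l n k (f ∘ suc)))

  ∑ᵛ-head : ∀ l n (f : Vec (Fin l) (suc n) → A) (h : ℕ → A) →
            (∀ x → ∑ᵛ l n (λ v → f (x ∷ v)) ≡ h (toℕ x)) → ∑ᵛ l (suc n) f ≡ ∑ l h
  ∑ᵛ-head l n f h = ∑ˡ-allFin l _ h

module ℕΣ = FiniteSums ℕP.+-*-isCommutativeSemiring
module ℤΣ = FiniteSums ℤP.+-*-isCommutativeSemiring
module 𝔹Σ = FiniteSums 𝔹P.∨-∧-isCommutativeSemiring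

open ℕΣ using (𝟙)
open ℤΣ using (when)

ℕ∑-const : ∀ n c → ℕΣ.∑ n (λ _ → c) ≡ n * c
ℕ∑-const zero    c = refl
ℕ∑-const (suc n) c = cong (_+_ c) (ℕ∑-const n c)

ℤ∑-neg : ∀ n f → ℤΣ.∑ n (λ j → ℤ.- f j) ≡ ℤ.- ℤΣ.∑ n f
ℤ∑-neg n f = begin
  ℤΣ.∑ n (λ j → ℤ.- f j)         ≡⟨ ℤΣ.∑-cong n (λ j _ → sym (ℤP.-1*i≡-i (f j))) ⟩
  ℤΣ.∑ n (λ j → ℤ.-1ℤ ℤ.* f j)   ≡⟨ ℤΣ.∑-distribˡ-⊗ n ℤ.-1ℤ f ⟩
  ℤ.-1ℤ ℤ.* ℤΣ.∑ n f             ≡⟨ ℤP.-1*i≡-i _ ⟩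
  ℤ.- ℤΣ.∑ n f                   ∎
  where open ≡-Reasoning

when-neg : ∀ b x → when b (ℤ.- x) ≡ ℤ.- when b x
when-neg true  x = refl
when-neg false x = refl

indicator≡𝟙 : ∀ {P : Set} (P? : Dec P) → indicator P? ≡ 𝟙 (does P?)
indicator≡𝟙 (yes _) = refl
indicator≡𝟙 (no _)  = refl

𝟙-∧ : ∀ a b → 𝟙 (a ∧ b) ≡ 𝟙 a * 𝟙 b
𝟙-∧ true  b = sym (ℕP.+-identityʳ (𝟙 b))
𝟙-∧ false b = refl

𝟙-∧-when : ∀ a b → 𝟙 (a ∧ b) ≡ ℕΣ.when a (𝟙 b)
𝟙-∧-when true  b = refl
𝟙-∧-when false b = refl

𝟙-∧-* : ∀ a b X → 𝟙 (a ∧ b) * X ≡ ℕΣ.when a (𝟙 b * X)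
𝟙-∧-* true  b X = refl
𝟙-∧-* false b X = refl

T-∧⁺ : ∀ {a b} → T a → T b → T (a ∧ b)
T-∧⁺ {a} {b} ta tb = Equivalence.from (𝔹P.T-∧ {a} {b}) (ta , tb)

T-∧₁ : ∀ {a b} → T (a ∧ b) → T a
T-∧₁ {a} {b} = proj₁ ∘ Equivalence.to (𝔹P.T-∧ {a} {b})

T-∧₂ : ∀ {a b} → T (a ∧ b) → T b
T-∧₂ {a} {b} = proj₂ ∘ Equivalence.to (𝔹P.T-∧ {a} {b})

T-does : ∀ {P : Set} (P? : Dec P) → T (does P?) → P
T-does (yes p) _ = p

does-T : ∀ {P : Set} (P? : Dec P) → P → T (does P?)
does-T P? p = subst T (sym (dec-true P? p)) tt

length-filterᵇ : ∀ {A : Set} (f : A → Bool) xs → length (filterᵇ f xs) ≡ ℕΣ.∑ˡ (List.map (𝟙 ∘ f) xs)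
length-filterᵇ f []       = refl
length-filterᵇ f (x ∷ xs) with f x
... | true  = cong suc (length-filterᵇ f xs)
... | false = length-filterᵇ f xs

filterᵇ-filterᵇ : ∀ {A : Set} (f g : A → Bool) xs → filterᵇ f (filterᵇ g xs) ≡ filterᵇ (λ x → g x ∧ f x) xs
filterᵇ-filterᵇ f g []       = refl
filterᵇ-filterᵇ f g (x ∷ xs) with g x
... | false = filterᵇ-filterᵇ f g xs
... | true with f x
...   | true  = cong (x ∷_) (filterᵇ-filterᵇ f g xs)
...   | false = filterᵇ-filterᵇ f g xs

any-filterᵇ : ∀ {A : Set} (f g : A → Bool) xs → BL.any f (filterᵇ g xs) ≡ BL.any (λ x → g x ∧ f x) xs
any-filterᵇ f g []       = refl
any-filterᵇ f g (x ∷ xs) with g x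
... | false = any-filterᵇ f g xs
... | true  = cong (f x ∨_) (any-filterᵇ f g xs)

-- Primes and the Möbius function

prime≢1 : ∀ {p} → Prime p → p ≢ 1
prime≢1 pp = ℕ.nonTrivial⇒≢1 {{prime⇒nonTrivial pp}}

prime-∣-prime : ∀ {p q} → Prime p → Prime q → q ∣ p → q ≡ p
prime-∣-prime pp pq q∣p with prime⇒irreducible pp q∣p
... | inj₁ q≡1 = ⊥-elim (prime≢1 pq q≡1)
... | inj₂ q≡p = q≡p

prime-factor : ∀ n → 1 < n → ∃ λ p → Prime p × p ∣ n
prime-factor n@(suc _) 1<n with factorise n
... | record { factors = [] ; isFactorisation = eq } = ⊥-elim (ℕP.<⇒≢ 1<n (sym eq))
... | record { factors = p ∷ ps ; isFactorisation = eq ; factorsPrime = pp ∷ _ } =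
  p , pp , subst (p ∣_) (sym eq) (m∣m*n _)

prime∤⇒coprime : ∀ {p x} → Prime p → ¬ p ∣ x → Coprime x p
prime∤⇒coprime pp p∤x (d∣x , d∣p) with prime⇒irreducible pp d∣p
... | inj₁ d≡1 = d≡1
... | inj₂ refl = ⊥-elim (p∤x d∣x)

möbius : Bool → ℕ → ℤ
möbius squareful k = if squareful then + 0 else ℤ.-1ℤ ℤ.^ k

-- The prime searches inside μ n, over q < k; every k > n gives the value of μ n.
squareOfPrimeDivides : ℕ → ℕ → Bool
squareOfPrimeDivides k n = 𝔹Σ.∑ k (λ q → does (prime? q) ∧ does ((q * q) ∣? n))

primeDivisorCount : ℕ → ℕ → ℕ
primeDivisorCount k n = ℕΣ.∑ k (λ q → 𝟙 (does (prime? q) ∧ does (q ∣? n)))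

μ-unfold : ∀ n → μ n ≡ möbius (squareOfPrimeDivides (suc n) n) (primeDivisorCount (suc n) n)
μ-unfold n = cong₂ möbius
  (trans (any-filterᵇ (λ p → does ((p * p) ∣? n)) (does ∘ prime?) (upTo (suc n)))
         (𝔹Σ.∑ˡ-upTo (suc n) (λ q → does (prime? q) ∧ does ((q * q) ∣? n))))
  (begin
    length (filterᵇ (λ p → does (p ∣? n)) (filterᵇ (does ∘ prime?) (upTo (suc n))))
      ≡⟨ cong length (filterᵇ-filterᵇ (λ p → does (p ∣? n)) (does ∘ prime?) (upTo (suc n))) ⟩
    length (filterᵇ (λ q → does (prime? q) ∧ does (q ∣? n)) (upTo (suc n)))
      ≡⟨ length-filterᵇ (λ q → does (prime? q) ∧ does (q ∣? n)) (upTo (suc n)) ⟩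
    ℕΣ.∑ˡ (List.map (λ q → 𝟙 (does (prime? q) ∧ does (q ∣? n))) (upTo (suc n)))
      ≡⟨ ℕΣ.∑ˡ-upTo (suc n) (λ q → 𝟙 (does (prime? q) ∧ does (q ∣? n))) ⟩
    primeDivisorCount (suc n) n ∎)
  where open ≡-Reasoning

squareOfPrimeDivides-extend : ∀ n k → .{{NonZero n}} → suc n ≤ k →
                              squareOfPrimeDivides k n ≡ squareOfPrimeDivides (suc n) n
squareOfPrimeDivides-extend n k n<k = 𝔹Σ.∑-extend (suc n) k _ n<k λ j n<j _ →
  trans (cong (does (prime? j) ∧_) (dec-false ((j * j) ∣? n) (λ jj∣n → ℕP.<⇒≱ n<j (j≤n j jj∣n))))
        (𝔹P.∧-zeroʳ _)
  where
  j≤n : ∀ j → j * j ∣ n → j ≤ n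
  j≤n zero    _     = z≤n
  j≤n (suc j) jj∣n = ℕP.≤-trans (ℕP.m≤m*n (suc j) (suc j)) (∣⇒≤ jj∣n)

primeDivisorCount-extend : ∀ n k → .{{NonZero n}} → suc n ≤ k →
                           primeDivisorCount k n ≡ primeDivisorCount (suc n) n
primeDivisorCount-extend n k n<k = ℕΣ.∑-extend (suc n) k _ n<k λ j n<j _ →
  cong 𝟙 (trans (cong (does (prime? j) ∧_) (dec-false (j ∣? n) (λ j∣n → ℕP.<⇒≱ n<j (∣⇒≤ j∣n))))
                (𝔹P.∧-zeroʳ _))

prime²∣p*x⇒prime²∣x : ∀ {p q x} → Prime p → Prime q → ¬ p ∣ x → q * q ∣ p * x → q * q ∣ x
prime²∣p*x⇒prime²∣x {p} {q} {x} pp pq p∤x qq∣px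
  with euclidsLemma p x pq (∣-trans (m∣m*n q) qq∣px)
... | inj₁ q∣p rewrite prime-∣-prime pp pq q∣p =
  ⊥-elim (p∤x (*-cancelˡ-∣ p {{prime⇒nonZero pp}} qq∣px))
... | inj₂ (divides c refl)
  with euclidsLemma p c pq (*-cancelˡ-∣ q {{prime⇒nonZero pq}}
                              (subst (q * q ∣_) (trans (sym (ℕP.*-assoc p c q)) (ℕP.*-comm (p * c) q)) qq∣px))
...   | inj₁ q∣p = ⊥-elim (p∤x (subst (_∣ c * q) (prime-∣-prime pp pq q∣p) (n∣m*n c)))
...   | inj₂ q∣c = subst (q * q ∣_) (ℕP.*-comm q c) (*-monoʳ-∣ q q∣c)

module _ {p x : ℕ} (pp : Prime p) (p∤x : ¬ p ∣ x) where

  squareOfPrimeDivides-*-prime : ∀ k → squareOfPrimeDivides k (p * x) ≡ squareOfPrimeDivides k x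
  squareOfPrimeDivides-*-prime k = 𝔹Σ.∑-cong k (λ q _ → same q (prime? q))
    where
    same : ∀ q (q? : Dec (Prime q)) → does q? ∧ does ((q * q) ∣? p * x) ≡ does q? ∧ does ((q * q) ∣? x)
    same q (no _)   = refl
    same q (yes pq) = does-⇔ (mk⇔ (prime²∣p*x⇒prime²∣x pp pq p∤x) (∣n⇒∣m*n p)) ((q * q) ∣? p * x) ((q * q) ∣? x)

  primeDivisorCount-*-prime : ∀ k → p < k → primeDivisorCount k (p * x) ≡ suc (primeDivisorCount k x)
  primeDivisorCount-*-prime k p<k = begin
    primeDivisorCount k (p * x)
      ≡⟨ ℕΣ.∑-cong k (λ q _ → split q (prime? q)) ⟩
    ℕΣ.∑ k (λ q → 𝟙 (does (prime? q) ∧ does (q ∣? x)) + 𝟙 (does (q ≟ p)))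
      ≡⟨ ℕΣ.∑-distrib-⊕ k _ _ ⟩
    primeDivisorCount k x + ℕΣ.∑ k (λ q → 𝟙 (does (q ≟ p)))
      ≡⟨ cong (_+_ (primeDivisorCount k x)) (ℕΣ.∑-single k _ p p<k (λ q _ q≢p → cong 𝟙 (dec-false (q ≟ p) q≢p))) ⟩
    primeDivisorCount k x + 𝟙 (does (p ≟ p))
      ≡⟨ cong (λ b → primeDivisorCount k x + 𝟙 b) (dec-true (p ≟ p) refl) ⟩
    primeDivisorCount k x + 1
      ≡⟨ ℕP.+-comm _ 1 ⟩
    suc (primeDivisorCount k x) ∎
    where
    open ≡-Reasoning
    q∣px⇒q∣x : ∀ {q} → Prime q → q ≢ p → q ∣ p * x → q ∣ x
    q∣px⇒q∣x pq q≢p q∣px with euclidsLemma p x pq q∣px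
    ... | inj₁ q∣p = ⊥-elim (q≢p (prime-∣-prime pp pq q∣p))
    ... | inj₂ q∣x = q∣x
    split : ∀ q (q? : Dec (Prime q)) →
            𝟙 (does q? ∧ does (q ∣? p * x)) ≡ 𝟙 (does q? ∧ does (q ∣? x)) + 𝟙 (does (q ≟ p))
    split q (no ¬pq) = sym (cong 𝟙 (dec-false (q ≟ p) (λ { refl → ¬pq pp })))
    split q (yes pq) with q ≟ p
    ... | yes refl = trans (cong 𝟙 (dec-true (q ∣? p * x) (m∣m*n x)))
                           (sym (cong₂ (λ a b → 𝟙 a + 𝟙 b) (dec-false (q ∣? x) p∤x) (dec-true (q ≟ q) refl)))
    ... | no q≢p   = trans (cong 𝟙 (does-⇔ (mk⇔ (q∣px⇒q∣x pq q≢p) (∣n⇒∣m*n p)) (q ∣? p * x) (q ∣? x)))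
                           (sym (trans (cong (λ b → 𝟙 (does (q ∣? x)) + 𝟙 b) (dec-false (q ≟ p) q≢p))
                                       (ℕP.+-identityʳ _)))

  μ-*-prime : .{{NonZero x}} → μ (p * x) ≡ ℤ.- μ x
  μ-*-prime = begin
    μ (p * x)
      ≡⟨ μ-unfold (p * x) ⟩
    möbius (squareOfPrimeDivides k (p * x)) (primeDivisorCount k (p * x))
      ≡⟨ cong₂ möbius (squareOfPrimeDivides-*-prime k) (primeDivisorCount-*-prime k p<k) ⟩
    möbius (squareOfPrimeDivides k x) (suc (primeDivisorCount k x))
      ≡⟨ cong₂ (λ a c → möbius a (suc c)) (squareOfPrimeDivides-extend x k x<k)
                                          (primeDivisorCount-extend x k x<k) ⟩
    möbius (squareOfPrimeDivides (suc x) x) (suc (primeDivisorCount (suc x) x))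
      ≡⟨ möbius-suc (squareOfPrimeDivides (suc x) x) (primeDivisorCount (suc x) x) ⟩
    ℤ.- möbius (squareOfPrimeDivides (suc x) x) (primeDivisorCount (suc x) x)
      ≡⟨ cong ℤ.-_ (sym (μ-unfold x)) ⟩
    ℤ.- μ x ∎
    where
    open ≡-Reasoning
    instance _ = prime⇒nonZero pp
    k = suc (p * x)
    p<k : p < k
    p<k = s≤s (ℕP.m≤m*n p x)
    x<k : suc x ≤ k
    x<k = s≤s (ℕP.m≤n*m x p)
    möbius-suc : ∀ a c → möbius a (suc c) ≡ ℤ.- möbius a c
    möbius-suc true  c = refl
    möbius-suc false c = ℤP.-1*i≡-i _

μ-square : ∀ {p n} → Prime p → .{{NonZero n}} → p * p ∣ n → μ n ≡ + 0
μ-square {p} {n} pp pp∣n = trans (μ-unfold n) (cong (λ a → möbius a (primeDivisorCount (suc n) n)) found)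
  where
  p≤n : p ≤ n
  p≤n = ℕP.≤-trans (ℕP.m≤m*n p p {{prime⇒nonZero pp}}) (∣⇒≤ pp∣n)
  ∨-true : ∀ k (f : ℕ → Bool) j → j < k → f j ≡ true → 𝔹Σ.∑ k f ≡ true
  ∨-true (suc k) f zero    _         fj = cong (_∨ 𝔹Σ.∑ k (f ∘ suc)) fj
  ∨-true (suc k) f (suc j) (s≤s j<k) fj = trans (cong (f 0 ∨_) (∨-true k (f ∘ suc) j j<k fj)) (𝔹P.∨-zeroʳ _)
  found : squareOfPrimeDivides (suc n) n ≡ true
  found = ∨-true (suc n) (λ q → does (prime? q) ∧ does ((q * q) ∣? n)) p (s≤s p≤n)
                 (cong₂ _∧_ (dec-true (prime? p) pp) (dec-true ((p * p) ∣? n) pp∣n))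

-- Divisor sums and Jordan's totient

-- Sums over the divisors d < k of n; for n ≠ 0 every bound k > n gives Σ_{d ∣ n} f d.
divisorSum : ℕ → ℕ → (ℕ → ℤ) → ℤ
divisorSum k n f = ℤΣ.∑ k (λ d → when (does (d ∣? n)) (f d))

divisorSum-extend : ∀ n k f → .{{NonZero n}} → suc n ≤ k → divisorSum k n f ≡ divisorSum (suc n) n f
divisorSum-extend n k f n<k = ℤΣ.∑-extend (suc n) k _ n<k λ j n<j _ →
  cong (λ b → when b (f j)) (dec-false (j ∣? n) (λ j∣n → ℕP.<⇒≱ n<j (∣⇒≤ j∣n)))

divisorSum-cong : ∀ k n (f g : ℕ → ℤ) → (∀ d → d ∣ n → f d ≡ g d) → divisorSum k n f ≡ divisorSum k n g
divisorSum-cong k n f g f≡g = ℤΣ.∑-cong k (λ d _ → on-divisors d (d ∣? n))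
  where
  on-divisors : ∀ d (d∣n? : Dec (d ∣ n)) → when (does d∣n?) (f d) ≡ when (does d∣n?) (g d)
  on-divisors d (yes d∣n) = cong (when true) (f≡g d d∣n)
  on-divisors d (no _)    = refl

divisorSum-zero : ∀ k n (f : ℕ → ℤ) → (∀ d → d ∣ n → f d ≡ + 0) → divisorSum k n f ≡ + 0
divisorSum-zero k n f f≡0 =
  trans (divisorSum-cong k n f (λ _ → + 0) f≡0) (ℤΣ.∑-zero k (λ d _ → ℤΣ.when-ε (does (d ∣? n))))

divisorSum-linear : ∀ k n (c a : ℤ) (f g : ℕ → ℤ) →
                    divisorSum k n (λ d → c ℤ.* (f d ℤ.+ a ℤ.* g d)) ≡ c ℤ.* (divisorSum k n f ℤ.+ a ℤ.* divisorSum k n g)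
divisorSum-linear k n c a f g = begin
  divisorSum k n (λ d → c ℤ.* (f d ℤ.+ a ℤ.* g d))
    ≡⟨ ℤΣ.∑-cong k (λ d _ → when-linear (does (d ∣? n)) d) ⟩
  ℤΣ.∑ k (λ d → c ℤ.* (F d ℤ.+ a ℤ.* G d))
    ≡⟨ ℤΣ.∑-distribˡ-⊗ k c _ ⟩
  c ℤ.* ℤΣ.∑ k (λ d → F d ℤ.+ a ℤ.* G d)
    ≡⟨ cong (c ℤ.*_) (ℤΣ.∑-distrib-⊕ k F (λ d → a ℤ.* G d)) ⟩
  c ℤ.* (ℤΣ.∑ k F ℤ.+ ℤΣ.∑ k (λ d → a ℤ.* G d))
    ≡⟨ cong (λ t → c ℤ.* (ℤΣ.∑ k F ℤ.+ t)) (ℤΣ.∑-distribˡ-⊗ k a G) ⟩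
  c ℤ.* (divisorSum k n f ℤ.+ a ℤ.* divisorSum k n g) ∎
  where
  open ≡-Reasoning
  F = λ d → when (does (d ∣? n)) (f d)
  G = λ d → when (does (d ∣? n)) (g d)
  when-linear : ∀ b d → when b (c ℤ.* (f d ℤ.+ a ℤ.* g d)) ≡ c ℤ.* (when b (f d) ℤ.+ a ℤ.* when b (g d))
  when-linear true  d = refl
  when-linear false d = sym (trans (cong (λ t → c ℤ.* (+ 0 ℤ.+ t)) (ℤP.*-zeroʳ a)) (ℤP.*-zeroʳ c))

-- Splitting the divisors of p * n by divisibility by p; μ (p * w) = - μ w makes the two halves cancel.
module _ {p n : ℕ} (pp : Prime p) .{{_ : NonZero n}} where

  private
    instance _ = prime⇒nonZero pp
    instance _ = ℕP.m*n≢0 p n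
    μ∣pn : ℕ → ℤ
    μ∣pn x = when (does (x ∣? p * n)) (μ x)

  μ-divisors-prime-to-p : ℕ → ℤ
  μ-divisors-prime-to-p w = when (not (does (p ∣? w))) (when (does (w ∣? n)) (μ w))

  ∑-μ-divisors-not-multiple : ℤΣ.∑ (suc (p * n)) (λ x → when (not (does (p ∣? x))) (μ∣pn x))
                              ≡ ℤΣ.∑ (suc n) μ-divisors-prime-to-p
  ∑-μ-divisors-not-multiple =
    trans (ℤΣ.∑-cong (suc (p * n)) (λ x _ → coprime-divisor-of-pn x))
          (ℤΣ.∑-extend (suc n) (suc (p * n)) _ (s≤s (ℕP.m≤n*m n p)) (λ j n<j _ → beyond j n<j))
    where
    coprime-divisor-of-pn : ∀ x → when (not (does (p ∣? x))) (μ∣pn x) ≡ μ-divisors-prime-to-p x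
    coprime-divisor-of-pn x with p ∣? x
    ... | yes _   = refl
    ... | no p∤x = cong (λ b → when b (μ x))
                        (does-⇔ (mk⇔ (coprime-divisor (prime∤⇒coprime pp p∤x)) (∣n⇒∣m*n p)) (x ∣? p * n) (x ∣? n))
    beyond : ∀ j → n < j → μ-divisors-prime-to-p j ≡ + 0
    beyond j n<j with does (p ∣? j)
    ... | true  = refl
    ... | false = cong (λ b → when b (μ j)) (dec-false (j ∣? n) (λ j∣n → ℕP.<⇒≱ n<j (∣⇒≤ j∣n)))

  ∑-μ-divisors-multiple : ℤΣ.∑ (suc (p * n)) (λ x → when (does (p ∣? x)) (μ∣pn x))
                          ≡ ℤ.- ℤΣ.∑ (suc n) μ-divisors-prime-to-p
  ∑-μ-divisors-multiple = begin
    ℤΣ.∑ (suc (p * n)) (λ x → when (does (p ∣? x)) (μ∣pn x))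
      ≡⟨ sym (ℤΣ.∑-extend (suc (p * n)) (p * suc n) _ pn<p[n+1] beyond) ⟩
    ℤΣ.∑ (p * suc n) (λ x → when (does (p ∣? x)) (μ∣pn x))
      ≡⟨ ℤΣ.∑-multiples p (suc n) μ∣pn ⟩
    ℤΣ.∑ (suc n) (λ w → μ∣pn (p * w))
      ≡⟨ ℤΣ.∑-cong (suc n) (λ w _ → μ∣pn-p* w) ⟩
    ℤΣ.∑ (suc n) (λ w → ℤ.- μ-divisors-prime-to-p w)
      ≡⟨ ℤ∑-neg (suc n) μ-divisors-prime-to-p ⟩
    ℤ.- ℤΣ.∑ (suc n) μ-divisors-prime-to-p ∎
    where
    open ≡-Reasoning
    pn<p[n+1] : suc (p * n) ≤ p * suc n
    pn<p[n+1] = subst (suc (p * n) ≤_) (trans (ℕP.+-comm (p * n) p) (sym (ℕP.*-suc p n)))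
                      (subst (_≤ p * n + p) (ℕP.+-comm (p * n) 1) (ℕP.+-monoʳ-≤ (p * n) (ℕ.>-nonZero⁻¹ p)))
    beyond : ∀ j → suc (p * n) ≤ j → j < p * suc n → when (does (p ∣? j)) (μ∣pn j) ≡ + 0
    beyond j pn<j _ = trans (cong (λ b → when (does (p ∣? j)) (when b (μ j)))
                                  (dec-false (j ∣? p * n) (λ j∣pn → ℕP.<⇒≱ pn<j (∣⇒≤ j∣pn))))
                            (ℤΣ.when-ε (does (p ∣? j)))
    μ∣pn-p* : ∀ w → μ∣pn (p * w) ≡ ℤ.- μ-divisors-prime-to-p w
    μ∣pn-p* w with p ∣? w
    ... | yes (divides w′ refl) with (p * (w′ * p)) ∣? p * n
    ...   | no _       = refl
    ...   | yes pw∣pn = μ-square pp {{ℕ.≢-nonZero λ pw≡0 → ℕ.≢-nonZero⁻¹ (p * n) (0∣⇒≡0 (subst (_∣ p * n) pw≡0 pw∣pn))}}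
                          (subst (p * p ∣_) (trans (sym (ℕP.*-assoc w′ p p)) (ℕP.*-comm (w′ * p) p))
                                 (∣n⇒∣m*n w′ ∣-refl))
    μ∣pn-p* w | no p∤w with w ∣? n
    ...   | yes w∣n = trans (cong (λ b → when b (μ (p * w))) (dec-true ((p * w) ∣? p * n) (*-monoʳ-∣ p w∣n)))
                            (μ-*-prime pp p∤w {{ℕ.≢-nonZero λ { refl → ℕ.≢-nonZero⁻¹ n (0∣⇒≡0 w∣n) }}})
    ...   | no w∤n  = cong (λ b → when b (μ (p * w))) (dec-false ((p * w) ∣? p * n) (w∤n ∘ *-cancelˡ-∣ p))

  ∑-μ-divisors-*-prime : divisorSum (suc (p * n)) (p * n) μ ≡ + 0
  ∑-μ-divisors-*-prime = begin
    divisorSum (suc (p * n)) (p * n) μ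
      ≡⟨ ℤΣ.∑-cong (suc (p * n)) (λ x _ → sym (ℤΣ.when-not (does (p ∣? x)) (μ∣pn x))) ⟩
    ℤΣ.∑ (suc (p * n)) (λ x → when (does (p ∣? x)) (μ∣pn x) ℤ.+ when (not (does (p ∣? x))) (μ∣pn x))
      ≡⟨ ℤΣ.∑-distrib-⊕ (suc (p * n)) (λ x → when (does (p ∣? x)) (μ∣pn x))
                                      (λ x → when (not (does (p ∣? x))) (μ∣pn x)) ⟩
    ℤΣ.∑ (suc (p * n)) (λ x → when (does (p ∣? x)) (μ∣pn x))
      ℤ.+ ℤΣ.∑ (suc (p * n)) (λ x → when (not (does (p ∣? x))) (μ∣pn x))
      ≡⟨ cong₂ ℤ._+_ ∑-μ-divisors-multiple ∑-μ-divisors-not-multiple ⟩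
    ℤ.- ℤΣ.∑ (suc n) μ-divisors-prime-to-p ℤ.+ ℤΣ.∑ (suc n) μ-divisors-prime-to-p
      ≡⟨ ℤP.+-inverseˡ (ℤΣ.∑ (suc n) μ-divisors-prime-to-p) ⟩
    + 0 ∎
    where open ≡-Reasoning

∑-μ-divisors : ∀ n → .{{NonZero n}} → divisorSum (suc n) n μ ≡ (if does (n ≟ 1) then + 1 else + 0)
∑-μ-divisors 1                 = refl
∑-μ-divisors n@(suc (suc _)) with prime-factor n (s≤s (s≤s z≤n))
... | p , pp , divides n′ n≡n′p =
  trans (cong (λ m → divisorSum (suc m) m μ) (trans n≡n′p (ℕP.*-comm n′ p)))
        (∑-μ-divisors-*-prime pp {{ℕ.≢-nonZero λ { refl → ℕ.≢-nonZero⁻¹ n n≡n′p } }})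

-- n / d, with the junk value n / 0 = 0 so that no NonZero instance is needed
infixl 7 _÷_
_÷_ : ℕ → ℕ → ℕ
n ÷ zero  = 0
n ÷ suc d = n / suc d

÷-≡ : ∀ n d q → d * q ≡ n → .{{NonZero d}} → n ÷ d ≡ q
÷-≡ n (suc d) q refl = trans (cong (_/ suc d) (ℕP.*-comm (suc d) q)) (m*n/n≡m q (suc d))

∑-unique-cofactor : ∀ n k b (h : ℕ → ℤ) → .{{NonZero n}} → suc n ≤ k →
                    ℤΣ.∑ k (λ a → when (does ((a * b) ≟ n)) (h a)) ≡ when (does (b ∣? n)) (h (n ÷ b))
∑-unique-cofactor n k b h n<k with b ∣? n
... | no b∤n = ℤΣ.∑-zero k (λ a _ → cong (λ t → when t (h a)) (dec-false ((a * b) ≟ n) (λ ab≡n → b∤n (divides a (sym ab≡n)))))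
... | yes (divides q n≡qb) = begin
  ℤΣ.∑ k (λ a → when (does ((a * b) ≟ n)) (h a))
    ≡⟨ ℤΣ.∑-single k _ q q<k (λ a _ a≢q → cong (λ t → when t (h a)) (dec-false ((a * b) ≟ n) (a≢q ∘ cofactor-unique a))) ⟩
  when (does ((q * b) ≟ n)) (h q)
    ≡⟨ cong (λ t → when t (h q)) (dec-true ((q * b) ≟ n) (sym n≡qb)) ⟩
  h q
    ≡⟨ cong h (sym (÷-≡ n b q (trans (ℕP.*-comm b q) (sym n≡qb)))) ⟩
  h (n ÷ b) ∎
  where
  open ≡-Reasoning
  instance _ = ℕ.≢-nonZero λ { refl → ℕ.≢-nonZero⁻¹ n (trans n≡qb (ℕP.*-zeroʳ q)) }
  cofactor-unique : ∀ a → a * b ≡ n → a ≡ q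
  cofactor-unique a ab≡n = ℕP.*-cancelʳ-≡ a q b (trans ab≡n n≡qb)
  q<k : q < k
  q<k = ℕP.≤-trans (s≤s (∣⇒≤ (divides b (trans n≡qb (ℕP.*-comm q b))))) n<k

divisorSum-complement : ∀ n k (f : ℕ → ℤ) → .{{NonZero n}} → suc n ≤ k →
                        divisorSum k n f ≡ divisorSum k n (λ d → f (n ÷ d))
divisorSum-complement n k f n<k = begin
  divisorSum k n f
    ≡⟨ ℤΣ.∑-cong k (λ a _ → sym (trans (ℤΣ.∑-cong k (λ b _ → cong (λ t → when (does (t ≟ n)) (f a)) (ℕP.*-comm a b)))
                                        (∑-unique-cofactor n k a (λ _ → f a) n<k))) ⟩
  ℤΣ.∑ k (λ a → ℤΣ.∑ k (λ b → when (does ((a * b) ≟ n)) (f a)))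
    ≡⟨ ℤΣ.∑-comm k k _ ⟩
  ℤΣ.∑ k (λ b → ℤΣ.∑ k (λ a → when (does ((a * b) ≟ n)) (f a)))
    ≡⟨ ℤΣ.∑-cong k (λ b _ → ∑-unique-cofactor n k b f n<k) ⟩
  divisorSum k n (λ d → f (n ÷ d)) ∎
  where open ≡-Reasoning

jordanTerm : ℕ → ℕ → ℕ → ℤ
jordanTerm k n d = μ (n ÷ d) ℤ.* + (d ^ k)

-- Jordan k n sums over the indices d = suc j for j < n; the extra index d = 0 is not a divisor.
Jordan-divisorSum : ∀ k n → .{{NonZero n}} → Jordan k n ≡ divisorSum (suc n) n (jordanTerm k n)
Jordan-divisorSum k n = begin
  Jordan k n   ≡⟨ ℤΣ.∑ˡ-upTo n (λ j → when (does (suc j ∣? n)) (jordanTerm k n (suc j))) ⟩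
  S            ≡⟨ sym (ℤP.+-identityˡ S) ⟩
  + 0 ℤ.+ S    ≡⟨ cong (ℤ._+ S) (cong (λ t → when t (jordanTerm k n 0)) (sym (dec-false (0 ∣? n) 0∤n))) ⟩
  divisorSum (suc n) n (jordanTerm k n) ∎
  where
  open ≡-Reasoning
  S = ℤΣ.∑ n (λ j → when (does (suc j ∣? n)) (jordanTerm k n (suc j)))
  0∤n : ¬ 0 ∣ n
  0∤n 0∣n = ℕ.≢-nonZero⁻¹ n (0∣⇒≡0 0∣n)

^-distribʳ-* : ∀ m n k → (m * n) ^ k ≡ m ^ k * n ^ k
^-distribʳ-* m n zero    = refl
^-distribʳ-* m n (suc k) = trans (cong ((m * n) *_) (^-distribʳ-* m n k)) (ℕP.[m*n]*[o*p]≡[m*o]*[n*p] m n (m ^ k) (n ^ k))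

jordanTerm-* : ∀ k M n w → .{{NonZero M}} → .{{NonZero n}} → w ∣ n →
               jordanTerm k (M * n) (M * w) ≡ + (M ^ k) ℤ.* jordanTerm k n w
jordanTerm-* k M n w (divides c n≡cw) = begin
  μ (M * n ÷ (M * w)) ℤ.* + ((M * w) ^ k)    ≡⟨ cong₂ (λ a b → μ a ℤ.* + b) Mn÷Mw≡n÷w (^-distribʳ-* M w k) ⟩
  μ (n ÷ w) ℤ.* + (M ^ k * w ^ k)            ≡⟨ cong (μ (n ÷ w) ℤ.*_) (ℤP.pos-* (M ^ k) (w ^ k)) ⟩
  μ (n ÷ w) ℤ.* (+ (M ^ k) ℤ.* + (w ^ k))    ≡⟨ sym (ℤP.*-assoc (μ (n ÷ w)) _ _) ⟩
  μ (n ÷ w) ℤ.* + (M ^ k) ℤ.* + (w ^ k)      ≡⟨ cong (ℤ._* + (w ^ k)) (ℤP.*-comm (μ (n ÷ w)) _) ⟩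
  + (M ^ k) ℤ.* μ (n ÷ w) ℤ.* + (w ^ k)      ≡⟨ ℤP.*-assoc (+ (M ^ k)) _ _ ⟩
  + (M ^ k) ℤ.* jordanTerm k n w             ∎
  where
  open ≡-Reasoning
  instance _ = ℕ.≢-nonZero λ { refl → ℕ.≢-nonZero⁻¹ n (trans n≡cw (ℕP.*-zeroʳ c)) }
  instance _ = ℕP.m*n≢0 M w
  wc≡n : w * c ≡ n
  wc≡n = trans (ℕP.*-comm w c) (sym n≡cw)
  Mn÷Mw≡n÷w : M * n ÷ (M * w) ≡ n ÷ w
  Mn÷Mw≡n÷w = trans (÷-≡ (M * n) (M * w) c (trans (ℕP.*-assoc M w c) (cong (M *_) wc≡n))) (sym (÷-≡ n w c wc≡n))

Jfrac-∣ : ∀ k n M → .{{NonZero M}} → M ∣ n → Jfrac k n M ≡ Jordan k (n ÷ M)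
Jfrac-∣ k n M@(suc _) M∣n = cong (λ b → if b then Jordan k (n / M) else + 0) (dec-true (M ∣? n) M∣n)

Jfrac-∤ : ∀ k n M → ¬ M ∣ n → Jfrac k n M ≡ + 0
Jfrac-∤ k n zero    _   = refl
Jfrac-∤ k n (suc b) M∤n = cong (λ t → if t then Jordan k (n / suc b) else + 0) (dec-false (suc b ∣? n) M∤n)

-- Substitute d = M w.
divisorSum-multiples-Jordan : ∀ k n M → .{{NonZero n}} → .{{NonZero M}} →
  divisorSum (suc n) n (λ d → when (does (M ∣? d)) (jordanTerm k n d)) ≡ + (M ^ k) ℤ.* Jfrac k n M
divisorSum-multiples-Jordan k n M@(suc _) with M ∣? n
... | no M∤n = begin
  divisorSum (suc n) n (λ d → when (does (M ∣? d)) (jordanTerm k n d))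
    ≡⟨ ℤΣ.∑-zero (suc n) (λ d _ → vanish d (d ∣? n) (M ∣? d)) ⟩
  + 0
    ≡⟨ sym (ℤP.*-zeroʳ (+ (M ^ k))) ⟩
  + (M ^ k) ℤ.* + 0
    ≡⟨ cong (+ (M ^ k) ℤ.*_) (sym (Jfrac-∤ k n M M∤n)) ⟩
  + (M ^ k) ℤ.* Jfrac k n M ∎
  where
  vanish : ∀ d (d∣n? : Dec (d ∣ n)) (M∣d? : Dec (M ∣ d)) → when (does d∣n?) (when (does M∣d?) (jordanTerm k n d)) ≡ + 0
  vanish d (yes d∣n) (yes M∣d) = ⊥-elim (M∤n (∣-trans M∣d d∣n))
  vanish d (yes _)   (no _)    = refl
  vanish d (no _)    _         = refl
  open ≡-Reasoning
... | yes (divides n′ n≡n′M) = begin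
  divisorSum (suc n) n (λ d → when (does (M ∣? d)) (jordanTerm k n d))
    ≡⟨ ℤΣ.∑-cong (suc n) (λ d _ → ℤΣ.when-comm (does (d ∣? n)) (does (M ∣? d)) (jordanTerm k n d)) ⟩
  ℤΣ.∑ (suc n) (λ d → when (does (M ∣? d)) (G d))
    ≡⟨ sym (ℤΣ.∑-extend (suc n) (M * suc n′) _ n<M[n′+1] beyond) ⟩
  ℤΣ.∑ (M * suc n′) (λ d → when (does (M ∣? d)) (G d))
    ≡⟨ ℤΣ.∑-multiples M (suc n′) G ⟩
  ℤΣ.∑ (suc n′) (λ w → G (M * w))
    ≡⟨ ℤΣ.∑-cong (suc n′) (λ w _ → G-M* w) ⟩
  ℤΣ.∑ (suc n′) (λ w → + (M ^ k) ℤ.* when (does (w ∣? n′)) (jordanTerm k n′ w))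
    ≡⟨ ℤΣ.∑-distribˡ-⊗ (suc n′) (+ (M ^ k)) (λ w → when (does (w ∣? n′)) (jordanTerm k n′ w)) ⟩
  + (M ^ k) ℤ.* divisorSum (suc n′) n′ (jordanTerm k n′)
    ≡⟨ cong (+ (M ^ k) ℤ.*_) (sym (Jordan-divisorSum k n′)) ⟩
  + (M ^ k) ℤ.* Jordan k n′
    ≡⟨ cong (λ t → + (M ^ k) ℤ.* Jordan k t) (sym (÷-≡ n M n′ n≡Mn′′)) ⟩
  + (M ^ k) ℤ.* Jordan k (n ÷ M)
    ≡⟨ cong (+ (M ^ k) ℤ.*_) (sym (Jfrac-∣ k n M (divides n′ n≡n′M))) ⟩
  + (M ^ k) ℤ.* Jfrac k n M ∎
  where
  open ≡-Reasoning
  G : ℕ → ℤ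
  G d = when (does (d ∣? n)) (jordanTerm k n d)
  n≡Mn′ : n ≡ M * n′
  n≡Mn′ = trans n≡n′M (ℕP.*-comm n′ M)
  n≡Mn′′ : M * n′ ≡ n
  n≡Mn′′ = sym n≡Mn′
  instance _ = ℕ.≢-nonZero λ { refl → ℕ.≢-nonZero⁻¹ n (trans n≡Mn′ (ℕP.*-zeroʳ M)) }
  n<M[n′+1] : suc n ≤ M * suc n′
  n<M[n′+1] = subst (suc n ≤_) (trans (cong (_+_ M) n≡Mn′) (sym (ℕP.*-suc M n′))) (s≤s (ℕP.m≤n+m n _))
  beyond : ∀ j → suc n ≤ j → j < M * suc n′ → when (does (M ∣? j)) (G j) ≡ + 0
  beyond j n<j _ = trans (cong (λ b → when (does (M ∣? j)) (when b (jordanTerm k n j)))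
                               (dec-false (j ∣? n) (λ j∣n → ℕP.<⇒≱ n<j (∣⇒≤ j∣n))))
                         (ℤΣ.when-ε (does (M ∣? j)))
  G-M* : ∀ w → G (M * w) ≡ + (M ^ k) ℤ.* when (does (w ∣? n′)) (jordanTerm k n′ w)
  G-M* w with w ∣? n′
  ... | no w∤n′ = trans (cong (λ t → when t (jordanTerm k n (M * w)))
                              (dec-false ((M * w) ∣? n) (λ Mw∣n → w∤n′ (*-cancelˡ-∣ M (subst (M * w ∣_) n≡Mn′ Mw∣n)))))
                        (sym (ℤP.*-zeroʳ (+ (M ^ k))))
  ... | yes w∣n′ = trans (cong (λ t → when t (jordanTerm k n (M * w))) (dec-true ((M * w) ∣? n) Mw∣n))
                         (trans (cong (λ t → jordanTerm k t (M * w)) n≡Mn′) (jordanTerm-* k M n′ w w∣n′))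
    where
    Mw∣n : M * w ∣ n
    Mw∣n = subst (M * w ∣_) n≡Mn′′ (*-monoʳ-∣ M w∣n′)

Jfrac-double : ∀ k n M → .{{NonZero M}} → Jfrac k (2 * n) (2 * M) ≡ Jfrac k n M
Jfrac-double k n M with M ∣? n
... | yes M∣n@(divides c n≡cM) = begin
  Jfrac k (2 * n) (2 * M)   ≡⟨ Jfrac-∣ k (2 * n) (2 * M) (*-monoʳ-∣ 2 M∣n) ⟩
  Jordan k (2 * n ÷ (2 * M)) ≡⟨ cong (Jordan k) (trans (÷-≡ (2 * n) (2 * M) c 2Mc≡2n) (sym (÷-≡ n M c Mc≡n))) ⟩
  Jordan k (n ÷ M)           ≡⟨ sym (Jfrac-∣ k n M M∣n) ⟩
  Jfrac k n M                ∎
  where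
  open ≡-Reasoning
  instance _ = ℕP.m*n≢0 2 M
  Mc≡n : M * c ≡ n
  Mc≡n = trans (ℕP.*-comm M c) (sym n≡cM)
  2Mc≡2n : 2 * M * c ≡ 2 * n
  2Mc≡2n = trans (ℕP.*-assoc 2 M c) (cong (2 *_) Mc≡n)
... | no M∤n = trans (Jfrac-∤ k (2 * n) (2 * M) (M∤n ∘ *-cancelˡ-∣ 2)) (sym (Jfrac-∤ k n M M∤n))

-- Homomorphisms Γ → ℤ_l

module _ (l : ℕ) .{{_ : NonZero l}} where

  l∣d*x⇒l∣d*gcd : ∀ d x → l ∣ d * x → l ∣ d * gcd x l
  l∣d*x⇒l∣d*gcd d x l∣dx = subst (l ∣_) (sym (c*gcd[m,n]≡gcd[cm,cn] d x l)) (gcd-greatest l∣dx (n∣m*n d))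

  l∣d*gcd⇒l∣d*x : ∀ d x → l ∣ d * gcd x l → l ∣ d * x
  l∣d*gcd⇒l∣d*x d x l∣dg = ∣-trans l∣dg (*-monoʳ-∣ d (gcd[m,n]∣m x l))

  gcd[x,l]≢0 : ∀ x → gcd x l ≢ 0
  gcd[x,l]≢0 x = gcd[m,n]≢0 x l (inj₂ (ℕ.≢-nonZero⁻¹ l))

  -- x ∈ ℤ_l has order exactly m iff its subgroup ⟨x⟩ = gcd(x, l) ℤ_l has m elements.
  hasOrder⇔ : ∀ {r g} (ms : Vec ℕ r) (x : Fin l) m → HasOrder l {g = g} ms x m ⇔ (gcd (toℕ x) l * m ≡ l)
  hasOrder⇔ {g = g} ms x m = mk⇔ to from
    where
    X = toℕ x
    G = gcd X l
    instance _ = ℕ.≢-nonZero (gcd[x,l]≢0 X)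
    to : HasOrder l {g = g} ms x m → G * m ≡ l
    to (1≤m , l∣mX , minimal) with gcd[m,n]∣n X l
    ... | divides L l≡LG = trans (cong (G *_) (sym L≡m)) (trans (ℕP.*-comm G L) (sym l≡LG))
      where
      instance _ = ℕ.>-nonZero 1≤m
      L∣m : L ∣ m
      L∣m = *-cancelʳ-∣ G (subst (_∣ m * G) l≡LG (l∣d*x⇒l∣d*gcd m X l∣mX))
      L≢0 : L ≢ 0
      L≢0 refl = ℕ.≢-nonZero⁻¹ l l≡LG
      L≡m : L ≡ m
      L≡m with ℕP.m≤n⇒m<n∨m≡n (∣⇒≤ L∣m)
      ... | inj₂ L≡m = L≡m
      ... | inj₁ L<m = ⊥-elim (minimal (Fin.fromℕ< L<m) (subst (1 ≤_) (sym toℕL≡L) (ℕP.n≢0⇒n>0 L≢0))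
                                       (subst (λ t → l ∣ t * X) (sym toℕL≡L) (l∣d*gcd⇒l∣d*x L X (subst (l ∣_) l≡LG ∣-refl))))
        where toℕL≡L = FinP.toℕ-fromℕ< L<m
    from : G * m ≡ l → HasOrder l {g = g} ms x m
    from Gm≡l = 1≤m , l∣d*gcd⇒l∣d*x m X (subst (l ∣_) l≡mG ∣-refl) , minimal
      where
      l≡mG : l ≡ m * G
      l≡mG = trans (sym Gm≡l) (ℕP.*-comm G m)
      1≤m : 1 ≤ m
      1≤m = ℕP.n≢0⇒n>0 λ { refl → ℕ.≢-nonZero⁻¹ l (trans (sym Gm≡l) (ℕP.*-zeroʳ G)) }
      minimal : ∀ (d : Fin m) → 1 ≤ toℕ d → ¬ (l ∣ toℕ d * X)
      minimal d 1≤d l∣dX = ℕP.<⇒≱ (FinP.toℕ<n d) (∣⇒≤ {{ℕ.>-nonZero 1≤d}} m∣d)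
        where
        m∣d : m ∣ toℕ d
        m∣d = *-cancelʳ-∣ G (subst (_∣ toℕ d * G) l≡mG (l∣d*x⇒l∣d*gcd (toℕ d) X l∣dX))

  gcdᵛ : ∀ {n} → Vec (Fin l) n → ℕ → ℕ
  gcdᵛ []      a = a
  gcdᵛ (x ∷ v) a = gcd (toℕ x) (gcdᵛ v a)

  generatorGcd : ∀ {r g} → Vec (Fin l) r → Vec (Fin l) g → ℕ
  generatorGcd y z = gcdᵛ y (gcdᵛ z l)

  ∣gcdᵛ⇒∣base : ∀ {n} (v : Vec (Fin l) n) a {d} → d ∣ gcdᵛ v a → d ∣ a
  ∣gcdᵛ⇒∣base []      a d∣a = d∣a
  ∣gcdᵛ⇒∣base (x ∷ v) a d∣g = ∣gcdᵛ⇒∣base v a (∣-trans d∣g (gcd[m,n]∣n (toℕ x) (gcdᵛ v a)))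

  ∣gcdᵛ⇒∣lin : ∀ {n} (v : Vec (Fin l) n) a (c : Vec (Fin l) n) {d} → d ∣ gcdᵛ v a → d ∣ lin c v
  ∣gcdᵛ⇒∣lin []      a []       d∣g = _ ∣0
  ∣gcdᵛ⇒∣lin (x ∷ v) a (c₀ ∷ c) d∣g =
    ∣m∣n⇒∣m+n (∣n⇒∣m*n (toℕ c₀) (∣-trans d∣g (gcd[m,n]∣m (toℕ x) (gcdᵛ v a))))
              (∣gcdᵛ⇒∣lin v a c (∣-trans d∣g (gcd[m,n]∣n (toℕ x) (gcdᵛ v a))))

  generatorGcd∣l : ∀ {r g} (y : Vec (Fin l) r) (z : Vec (Fin l) g) → generatorGcd y z ∣ l
  generatorGcd∣l y z = ∣gcdᵛ⇒∣base z l (∣gcdᵛ⇒∣base y _ ∣-refl)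

  surjective⇒generatorGcd≡1 : ∀ {r g} (ms : Vec ℕ r) (y : Vec (Fin l) r) (z : Vec (Fin l) g) →
                              Surjective l ms y z → generatorGcd y z ≡ 1
  surjective⇒generatorGcd≡1 ms y z onto with l ≟ 1
  ... | yes l≡1 = ∣1⇒≡1 (subst (generatorGcd y z ∣_) l≡1 (generatorGcd∣l y z))
  ... | no l≢1 with onto (Fin.fromℕ< 1<l)
    where
    1<l : 1 < l
    1<l = ℕP.≤∧≢⇒< (ℕ.>-nonZero⁻¹ l) (l≢1 ∘ sym)
  ...   | c , e , hits1 = ∣1⇒≡1 (subst (D ∣_) (trans hits1 (FinP.toℕ-fromℕ< _))
                                          (%-presˡ-∣ (∣m∣n⇒∣m+n (∣gcdᵛ⇒∣lin y _ c ∣-refl)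
                                                                (∣gcdᵛ⇒∣lin z l e (∣gcdᵛ⇒∣base y _ ∣-refl)))
                                                     (generatorGcd∣l y z)))
    where D = generatorGcd y z

  infix 4 _≡ₗ_
  _≡ₗ_ : ℕ → ℕ → Set
  a ≡ₗ b = a % l ≡ b % l

  +-cong-≡ₗ : ∀ {a a′ b b′} → a ≡ₗ a′ → b ≡ₗ b′ → a + b ≡ₗ a′ + b′
  +-cong-≡ₗ {a} {a′} {b} {b′} a≡a′ b≡b′ =
    trans (%-distribˡ-+ a b l) (trans (cong₂ (λ u v → (u + v) % l) a≡a′ b≡b′) (sym (%-distribˡ-+ a′ b′ l)))

  *-congʳ-≡ₗ : ∀ {a a′} k → a ≡ₗ a′ → a * k ≡ₗ a′ * k
  *-congʳ-≡ₗ {a} {a′} k a≡a′ =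
    trans (%-distribˡ-* a k l) (trans (cong (λ u → (u * (k % l)) % l) a≡a′) (sym (%-distribˡ-* a′ k l)))

  *-congˡ-≡ₗ : ∀ {a a′} k → a ≡ₗ a′ → k * a ≡ₗ k * a′
  *-congˡ-≡ₗ {a} {a′} k a≡a′ = subst₂ _≡ₗ_ (ℕP.*-comm a k) (ℕP.*-comm a′ k) (*-congʳ-≡ₗ k a≡a′)

  %-≡ₗ : ∀ a → a % l ≡ₗ a
  %-≡ₗ a = m%n%n≡m%n a l

  -- Natural coefficients suffice mod l: subtracting b y is adding b (l ∸ 1) y.
  bézout-≡ₗ : ∀ x y → ∃₂ λ a b → a * x + b * y ≡ₗ gcd x y
  bézout-≡ₗ x y with Bézout.identity (gcd-GCD x y)
  ... | Bézout.+- a b g+by≡ax = a , b * (l ∸ 1) , (begin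
    (a * x + b * (l ∸ 1) * y) % l       ≡⟨ cong (λ t → (t + b * (l ∸ 1) * y) % l) (sym g+by≡ax) ⟩
    (gcd x y + b * y + b * (l ∸ 1) * y) % l ≡⟨ cong (_% l) (lemma (gcd x y) b y (l ∸ 1)) ⟩
    (gcd x y + b * y * suc (l ∸ 1)) % l ≡⟨ cong (λ t → (gcd x y + b * y * t) % l) l≡ ⟩
    (gcd x y + b * y * l) % l           ≡⟨ [m+kn]%n≡m%n (gcd x y) (b * y) l ⟩
    gcd x y % l                         ∎)
    where
    open ≡-Reasoning
    l≡ = ℕP.suc-pred l
    lemma : ∀ g b y k → g + b * y + b * k * y ≡ g + b * y * suc k
    lemma = solve-∀
  ... | Bézout.-+ a b g+ax≡by = a * (l ∸ 1) , b , (begin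
    (a * (l ∸ 1) * x + b * y) % l       ≡⟨ cong (λ t → (a * (l ∸ 1) * x + t) % l) (sym g+ax≡by) ⟩
    (a * (l ∸ 1) * x + (gcd x y + a * x)) % l ≡⟨ cong (_% l) (lemma (gcd x y) a x (l ∸ 1)) ⟩
    (gcd x y + a * x * suc (l ∸ 1)) % l ≡⟨ cong (λ t → (gcd x y + a * x * t) % l) l≡ ⟩
    (gcd x y + a * x * l) % l           ≡⟨ [m+kn]%n≡m%n (gcd x y) (a * x) l ⟩
    gcd x y % l                         ∎)
    where
    open ≡-Reasoning
    l≡ = ℕP.suc-pred l
    lemma : ∀ g a x k → a * k * x + (g + a * x) ≡ g + a * x * suc k
    lemma = solve-∀

  -- f stands for the combinations of the generators outside v.
  lin-reaches-gcdᵛ : ∀ {n} (v : Vec (Fin l) n) b {W : Set} (f : W → ℕ) →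
                     (∀ T → ∃ λ w → f w ≡ₗ T * b) →
                     ∀ T → ∃₂ λ (c : Vec (Fin l) n) w → lin c v + f w ≡ₗ T * gcdᵛ v b
  lin-reaches-gcdᵛ []      b f reaches-b T = [] , reaches-b T
  lin-reaches-gcdᵛ (x ∷ v) b f reaches-b T with bézout-≡ₗ (toℕ x) (gcdᵛ v b)
  ... | a , a′ , bézout with lin-reaches-gcdᵛ v b f reaches-b (T * a′)
  ...   | c , w , reaches = Fin.fromℕ< (m%n<n (T * a) l) ∷ c , w , (begin
    (toℕ (Fin.fromℕ< (m%n<n (T * a) l)) * X + lin c v + f w) % l
      ≡⟨ cong (λ u → (u * X + lin c v + f w) % l) (FinP.toℕ-fromℕ< (m%n<n (T * a) l)) ⟩
    ((T * a) % l * X + lin c v + f w) % l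
      ≡⟨ cong (_% l) (ℕP.+-assoc ((T * a) % l * X) (lin c v) (f w)) ⟩
    ((T * a) % l * X + (lin c v + f w)) % l
      ≡⟨ +-cong-≡ₗ (*-congʳ-≡ₗ X (%-≡ₗ (T * a))) reaches ⟩
    (T * a * X + T * a′ * g′) % l
      ≡⟨ cong (_% l) (lemma T a X a′ g′) ⟩
    (T * (a * X + a′ * g′)) % l
      ≡⟨ *-congˡ-≡ₗ T bézout ⟩
    (T * gcd X g′) % l ∎)
    where
    open ≡-Reasoning
    X = toℕ x
    g′ = gcdᵛ v b
    lemma : ∀ T a X a′ g′ → T * a * X + T * a′ * g′ ≡ T * (a * X + a′ * g′)
    lemma = solve-∀

  generatorGcd≡1⇒surjective : ∀ {r g} (ms : Vec ℕ r) (y : Vec (Fin l) r) (z : Vec (Fin l) g) →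
                              generatorGcd y z ≡ 1 → Surjective l ms y z
  generatorGcd≡1⇒surjective ms y z D≡1 t
    with lin-reaches-gcdᵛ y (gcdᵛ z l) (λ e → lin e z) z-reaches (toℕ t)
    where
    z-reaches : ∀ T → ∃ λ e → lin e z ≡ₗ T * gcdᵛ z l
    z-reaches T with lin-reaches-gcdᵛ z l (λ (_ : ⊤) → 0) (λ T → tt , l-reaches T) T
      where
      l-reaches : ∀ T → 0 ≡ₗ T * l
      l-reaches T = trans (m<n⇒m%n≡m (ℕ.>-nonZero⁻¹ l)) (sym (m*n%n≡0 T l))
    ... | e , tt , reaches = e , trans (cong (_% l) (sym (ℕP.+-identityʳ (lin e z)))) reaches
  ... | c , e , reaches = c , e , (begin
    (lin c y + lin e z) % l         ≡⟨ reaches ⟩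
    (toℕ t * generatorGcd y z) % l ≡⟨ cong (λ u → (toℕ t * u) % l) D≡1 ⟩
    (toℕ t * 1) % l                 ≡⟨ cong (_% l) (ℕP.*-identityʳ (toℕ t)) ⟩
    toℕ t % l                       ≡⟨ m<n⇒m%n≡m (FinP.toℕ<n t) ⟩
    toℕ t                           ∎)
    where open ≡-Reasoning

-- Epi_o as a Möbius sum

sumVec≡∑ᵛ : ∀ l n f → sumVec l n f ≡ ℕΣ.∑ᵛ l n f
sumVec≡∑ᵛ l zero    f = refl
sumVec≡∑ᵛ l (suc n) f = ℕΣ.∑ˡ-map-cong (allFin l) (λ x → sumVec≡∑ᵛ l n (λ v → f (x ∷ v)))

+-∑ˡ : ∀ {B : Set} (xs : List B) (h : B → ℕ) → + ℕΣ.∑ˡ (List.map h xs) ≡ ℤΣ.∑ˡ (List.map (λ x → + h x) xs)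
+-∑ˡ []       h = refl
+-∑ˡ (x ∷ xs) h = trans (ℤP.pos-+ (h x) _) (cong (λ t → + h x ℤ.+ t) (+-∑ˡ xs h))

+-∑ᵛ : ∀ l n f → + ℕΣ.∑ᵛ l n f ≡ ℤΣ.∑ᵛ l n (λ v → + f v)
+-∑ᵛ l zero    f = refl
+-∑ᵛ l (suc n) f = trans (+-∑ˡ (allFin l) _) (ℤΣ.∑ˡ-map-cong (allFin l) (λ x → +-∑ᵛ l n (λ v → f (x ∷ v))))

module _ (l : ℕ) .{{_ : NonZero l}} where

  hasOrdersᵇ : ∀ {r} → Vec ℕ r → Vec (Fin l) r → Bool
  hasOrdersᵇ []       []      = true
  hasOrdersᵇ (m ∷ ms) (x ∷ y) = does ((gcd (toℕ x) l * m) ≟ l) ∧ hasOrdersᵇ ms y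

  dividesAllᵇ : ∀ {n} → ℕ → Vec (Fin l) n → Bool
  dividesAllᵇ e []      = true
  dividesAllᵇ e (x ∷ v) = does (e ∣? toℕ x) ∧ dividesAllᵇ e v

  -- HasOrder also carries the (irrelevant) periods ms₀ of the group as a module parameter.
  hasOrders⇔ : ∀ {r₀ g r} (ms₀ : Vec ℕ r₀) (ms : Vec ℕ r) y →
               (∀ i → HasOrder l {g = g} ms₀ (lookup y i) (lookup ms i)) ⇔ T (hasOrdersᵇ ms y)
  hasOrders⇔ {g = g} ms₀ ms y = mk⇔ (to ms y) (from ms y)
    where
    to : ∀ {r} (ms : Vec ℕ r) y → (∀ i → HasOrder l {g = g} ms₀ (lookup y i) (lookup ms i)) → T (hasOrdersᵇ ms y)
    to []       []      _      = tt
    to (m ∷ ms) (x ∷ y) orders =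
      T-∧⁺ (does-T ((gcd (toℕ x) l * m) ≟ l) (Equivalence.to (hasOrder⇔ l {g = g} ms₀ x m) (orders Fin.zero))) (to ms y (orders ∘ Fin.suc))
    from : ∀ {r} (ms : Vec ℕ r) y → T (hasOrdersᵇ ms y) → (∀ i → HasOrder l {g = g} ms₀ (lookup y i) (lookup ms i))
    from (m ∷ ms) (x ∷ y) t Fin.zero    = Equivalence.from (hasOrder⇔ l {g = g} ms₀ x m) (T-does ((gcd (toℕ x) l * m) ≟ l) (T-∧₁ t))
    from (m ∷ ms) (x ∷ y) t (Fin.suc i) = from ms y (T-∧₂ {does ((gcd (toℕ x) l * m) ≟ l)} t) i

  relationSum : ∀ {r g} → Vec (Fin l) r → Vec (Fin l) g → ℕ
  relationSum y z = vsum y + 2 * vsum z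

  indicator-isEpiO : ∀ {r g} (ms : Vec ℕ r) y z →
    indicator (isEpiO? l {g = g} ms y z)
    ≡ 𝟙 (does (l ∣? relationSum y z)) * (𝟙 (hasOrdersᵇ ms y) * 𝟙 (does (generatorGcd l y z ≟ 1)))
  indicator-isEpiO {g = g} ms y z = begin
    indicator (isEpiO? l ms y z)
      ≡⟨ indicator≡𝟙 (isEpiO? l ms y z) ⟩
    𝟙 (does (isEpiO? l ms y z))
      ≡⟨ cong 𝟙 (does-⇔ (mk⇔ to from) (isEpiO? l ms y z)
                        ((l ∣? relationSum y z) ×-dec (T? (hasOrdersᵇ ms y) ×-dec (generatorGcd l y z ≟ 1)))) ⟩
    𝟙 (does (l ∣? relationSum y z) ∧ (hasOrdersᵇ ms y ∧ does (generatorGcd l y z ≟ 1)))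
      ≡⟨ trans (𝟙-∧ (does (l ∣? relationSum y z)) _)
               (cong (𝟙 (does (l ∣? relationSum y z)) *_) (𝟙-∧ (hasOrdersᵇ ms y) (does (generatorGcd l y z ≟ 1)))) ⟩
    𝟙 (does (l ∣? relationSum y z)) * (𝟙 (hasOrdersᵇ ms y) * 𝟙 (does (generatorGcd l y z ≟ 1))) ∎
    where
    open ≡-Reasoning
    orders⇔ = hasOrders⇔ {g = g} ms ms y
    to : IsEpiO l ms y z → (l ∣ relationSum y z) × T (hasOrdersᵇ ms y) × (generatorGcd l y z ≡ 1)
    to ((l∣rel , _) , onto , orders) =
      l∣rel , Equivalence.to orders⇔ orders , surjective⇒generatorGcd≡1 l ms y z onto
    from : (l ∣ relationSum y z) × T (hasOrdersᵇ ms y) × (generatorGcd l y z ≡ 1) → IsEpiO l ms y z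
    from (l∣rel , t , D≡1) =
      (l∣rel , λ i → proj₁ (proj₂ (Equivalence.from orders⇔ t i))) ,
      generatorGcd≡1⇒surjective l ms y z D≡1 , Equivalence.from orders⇔ t

  imageIn : ∀ {r g} → ℕ → Vec (Fin l) r → Vec (Fin l) g → Bool
  imageIn e y z = dividesAllᵇ e y ∧ dividesAllᵇ e z

  ∣gcdᵛ⇒ : ∀ {n} (v : Vec (Fin l) n) a e → e ∣ gcdᵛ l v a → T (dividesAllᵇ e v) × e ∣ a
  ∣gcdᵛ⇒ []      a e e∣a = tt , e∣a
  ∣gcdᵛ⇒ (x ∷ v) a e e∣g with ∣gcdᵛ⇒ v a e (∣-trans e∣g (gcd[m,n]∣n (toℕ x) (gcdᵛ l v a)))
  ... | t , e∣a = T-∧⁺ (does-T (e ∣? toℕ x) (∣-trans e∣g (gcd[m,n]∣m (toℕ x) (gcdᵛ l v a)))) t , e∣a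

  ∣gcdᵛ⇐ : ∀ {n} (v : Vec (Fin l) n) a e → T (dividesAllᵇ e v) → e ∣ a → e ∣ gcdᵛ l v a
  ∣gcdᵛ⇐ []      a e t e∣a = e∣a
  ∣gcdᵛ⇐ (x ∷ v) a e t e∣a =
    gcd-greatest (T-does (e ∣? toℕ x) (T-∧₁ t)) (∣gcdᵛ⇐ v a e (T-∧₂ {does (e ∣? toℕ x)} t) e∣a)

  ∣generatorGcd : ∀ {r g} (y : Vec (Fin l) r) (z : Vec (Fin l) g) e →
                  does (e ∣? generatorGcd l y z) ≡ does (e ∣? l) ∧ imageIn e y z
  ∣generatorGcd y z e = does-⇔ (mk⇔ to from) (e ∣? generatorGcd l y z) ((e ∣? l) ×-dec T? (imageIn e y z))
    where
    to : e ∣ generatorGcd l y z → e ∣ l × T (imageIn e y z)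
    to e∣D with ∣gcdᵛ⇒ y (gcdᵛ l z l) e e∣D
    ... | ty , e∣g with ∣gcdᵛ⇒ z l e e∣g
    ...   | tz , e∣l = e∣l , T-∧⁺ ty tz
    from : e ∣ l × T (imageIn e y z) → e ∣ generatorGcd l y z
    from (e∣l , t) = ∣gcdᵛ⇐ y (gcdᵛ l z l) e (T-∧₁ t) (∣gcdᵛ⇐ z l e (T-∧₂ {dividesAllᵇ e y} t) e∣l)

  -- [gcd = 1] = Σ_{x ∣ gcd} μ x, the step that removes the surjectivity condition.
  𝟙[generatorGcd≡1] : ∀ {r g} (y : Vec (Fin l) r) (z : Vec (Fin l) g) →
                      + 𝟙 (does (generatorGcd l y z ≟ 1)) ≡ divisorSum (suc l) l (λ x → when (imageIn x y z) (μ x))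
  𝟙[generatorGcd≡1] y z = begin
    + 𝟙 (does (D ≟ 1))               ≡⟨ +𝟙 (does (D ≟ 1)) ⟩
    (if does (D ≟ 1) then + 1 else + 0) ≡⟨ sym (∑-μ-divisors D) ⟩
    divisorSum (suc D) D μ           ≡⟨ sym (divisorSum-extend D (suc l) μ (s≤s (∣⇒≤ (generatorGcd∣l l y z)))) ⟩
    divisorSum (suc l) D μ
      ≡⟨ ℤΣ.∑-cong (suc l) (λ x _ → trans (cong (λ b → when b (μ x)) (∣generatorGcd y z x))
                                          (ℤΣ.when-∧ (does (x ∣? l)) (imageIn x y z) (μ x))) ⟩
    divisorSum (suc l) l (λ x → when (imageIn x y z) (μ x)) ∎
    where
    open ≡-Reasoning
    D = generatorGcd l y z
    instance _ = ℕ.≢-nonZero λ D≡0 → ℕ.≢-nonZero⁻¹ l (0∣⇒≡0 (subst (_∣ l) D≡0 (generatorGcd∣l l y z)))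
    +𝟙 : ∀ b → + 𝟙 b ≡ (if b then + 1 else + 0)
    +𝟙 true  = refl
    +𝟙 false = refl

  module _ {r : ℕ} (g : ℕ) (ms : Vec ℕ r) where

    isOrderedHom : Vec (Fin l) r → Vec (Fin l) g → ℕ
    isOrderedHom y z = 𝟙 (does (l ∣? relationSum y z)) * 𝟙 (hasOrdersᵇ ms y)

    -- the homomorphisms with the prescribed orders whose image lies in e ℤ_l
    homsInto : ℕ → ℕ
    homsInto e = ℕΣ.∑ᵛ l r (λ y → ℕΣ.∑ᵛ l g (λ z → 𝟙 (imageIn e y z) * isOrderedHom y z))

    möbiusTerm : ℕ → Vec (Fin l) r → Vec (Fin l) g → ℤ
    möbiusTerm x y z = when (does (x ∣? l)) (μ x ℤ.* + (𝟙 (imageIn x y z) * isOrderedHom y z))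

    isOrderedHom-onto : ∀ y z → + (isOrderedHom y z * 𝟙 (does (generatorGcd l y z ≟ 1))) ≡ ℤΣ.∑ (suc l) (λ x → möbiusTerm x y z)
    isOrderedHom-onto y z = begin
      + (isOrderedHom y z * 𝟙 (does (generatorGcd l y z ≟ 1)))
        ≡⟨ ℤP.pos-* (isOrderedHom y z) _ ⟩
      + isOrderedHom y z ℤ.* + 𝟙 (does (generatorGcd l y z ≟ 1))
        ≡⟨ cong (+ isOrderedHom y z ℤ.*_) (𝟙[generatorGcd≡1] y z) ⟩
      + isOrderedHom y z ℤ.* divisorSum (suc l) l (λ x → when (imageIn x y z) (μ x))
        ≡⟨ sym (ℤΣ.∑-distribˡ-⊗ (suc l) (+ isOrderedHom y z) (λ x → when (does (x ∣? l)) (when (imageIn x y z) (μ x)))) ⟩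
      ℤΣ.∑ (suc l) (λ x → + isOrderedHom y z ℤ.* when (does (x ∣? l)) (when (imageIn x y z) (μ x)))
        ≡⟨ ℤΣ.∑-cong (suc l) (λ x _ → weigh (does (x ∣? l)) (imageIn x y z) (isOrderedHom y z) (μ x)) ⟩
      ℤΣ.∑ (suc l) (λ x → möbiusTerm x y z) ∎
      where
      open ≡-Reasoning
      weigh : ∀ a b X (m : ℤ) → + X ℤ.* when a (when b m) ≡ when a (m ℤ.* + (𝟙 b * X))
      weigh false b     X m = ℤP.*-zeroʳ (+ X)
      weigh true  false X m = trans (ℤP.*-zeroʳ (+ X)) (sym (ℤP.*-zeroʳ m))
      weigh true  true  X m = trans (ℤP.*-comm (+ X) m) (cong (λ t → m ℤ.* + t) (sym (ℕP.+-identityʳ X)))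

    ∑ᵛ-möbiusTerm : ∀ x → ℤΣ.∑ᵛ l r (λ y → ℤΣ.∑ᵛ l g (möbiusTerm x y)) ≡ when (does (x ∣? l)) (μ x ℤ.* + homsInto x)
    ∑ᵛ-möbiusTerm x = begin
      ℤΣ.∑ᵛ l r (λ y → ℤΣ.∑ᵛ l g (möbiusTerm x y))
        ≡⟨ ℤΣ.∑ᵛ-cong l r (λ y → trans (∑ᵛ-when-* g _) (cong (λ t → when x∣l (μ x ℤ.* t)) (sym (+-∑ᵛ l g _)))) ⟩
      ℤΣ.∑ᵛ l r (λ y → when x∣l (μ x ℤ.* + ℕΣ.∑ᵛ l g (λ z → 𝟙 (imageIn x y z) * isOrderedHom y z)))
        ≡⟨ ∑ᵛ-when-* r _ ⟩
      when x∣l (μ x ℤ.* ℤΣ.∑ᵛ l r (λ y → + ℕΣ.∑ᵛ l g (λ z → 𝟙 (imageIn x y z) * isOrderedHom y z)))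
        ≡⟨ cong (λ t → when x∣l (μ x ℤ.* t)) (sym (+-∑ᵛ l r _)) ⟩
      when x∣l (μ x ℤ.* + homsInto x) ∎
      where
      open ≡-Reasoning
      x∣l = does (x ∣? l)
      ∑ᵛ-when-* : ∀ n (f : Vec (Fin l) n → ℤ) → ℤΣ.∑ᵛ l n (λ v → when x∣l (μ x ℤ.* f v)) ≡ when x∣l (μ x ℤ.* ℤΣ.∑ᵛ l n f)
      ∑ᵛ-when-* n f = trans (ℤΣ.∑ᵛ-when l n x∣l (λ v → μ x ℤ.* f v)) (cong (when x∣l) (ℤΣ.∑ᵛ-distribˡ-⊗ l n (μ x) f))

    EpiO′-möbius : + EpiO' l {g = g} ms ≡ divisorSum (suc l) l (λ x → μ x ℤ.* + homsInto x)
    EpiO′-möbius = begin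
      + EpiO' l {g = g} ms
        ≡⟨ cong +_ (trans (sumVec≡∑ᵛ l r _) (ℕΣ.∑ᵛ-cong l r (λ y → trans (sumVec≡∑ᵛ l g _)
             (ℕΣ.∑ᵛ-cong l g (λ z → trans (indicator-isEpiO ms y z) (reassociate y z)))))) ⟩
      + ℕΣ.∑ᵛ l r (λ y → ℕΣ.∑ᵛ l g (λ z → isOrderedHom y z * 𝟙 (does (generatorGcd l y z ≟ 1))))
        ≡⟨ trans (+-∑ᵛ l r _) (ℤΣ.∑ᵛ-cong l r (λ y → +-∑ᵛ l g _)) ⟩
      ℤΣ.∑ᵛ l r (λ y → ℤΣ.∑ᵛ l g (λ z → + (isOrderedHom y z * 𝟙 (does (generatorGcd l y z ≟ 1)))))
        ≡⟨ ℤΣ.∑ᵛ-cong l r (λ y → ℤΣ.∑ᵛ-cong l g (isOrderedHom-onto y)) ⟩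
      ℤΣ.∑ᵛ l r (λ y → ℤΣ.∑ᵛ l g (λ z → ℤΣ.∑ (suc l) (λ x → möbiusTerm x y z)))
        ≡⟨ trans (ℤΣ.∑ᵛ-cong l r (λ y → ℤΣ.∑ᵛ-∑ l g (suc l) (λ x z → möbiusTerm x y z)))
                 (ℤΣ.∑ᵛ-∑ l r (suc l) (λ x y → ℤΣ.∑ᵛ l g (möbiusTerm x y))) ⟩
      ℤΣ.∑ (suc l) (λ x → ℤΣ.∑ᵛ l r (λ y → ℤΣ.∑ᵛ l g (möbiusTerm x y)))
        ≡⟨ ℤΣ.∑-cong (suc l) (λ x _ → ∑ᵛ-möbiusTerm x) ⟩
      divisorSum (suc l) l (λ x → μ x ℤ.* + homsInto x) ∎
      where
      open ≡-Reasoning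
      reassociate : ∀ y z → 𝟙 (does (l ∣? relationSum y z)) * (𝟙 (hasOrdersᵇ ms y) * 𝟙 (does (generatorGcd l y z ≟ 1)))
                            ≡ isOrderedHom y z * 𝟙 (does (generatorGcd l y z ≟ 1))
      reassociate y z = sym (ℕP.*-assoc (𝟙 (does (l ∣? relationSum y z))) (𝟙 (hasOrdersᵇ ms y)) _)

-- Counting in ℤ_n

module _ (n k c : ℕ) .{{_ : NonZero n}} (cop : Coprime n k) where

  private
    no-smaller-solution : ∀ {a b} → a < b → b < n → n ∣ c + k * a → n ∣ c + k * b → ⊥
    no-smaller-solution {a} {b} a<b b<n n∣a n∣b =
      ℕP.<⇒≱ (ℕP.≤-<-trans (ℕP.m∸n≤m b a) b<n) (∣⇒≤ {{ℕ.>-nonZero (ℕP.m<n⇒0<n∸m a<b)}} n∣b∸a)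
      where
      shift : c + k * b ≡ (c + k * a) + k * (b ∸ a)
      shift = trans (cong (λ t → c + k * t) (sym (ℕP.m+[n∸m]≡n (ℕP.<⇒≤ a<b))))
                    (trans (cong (_+_ c) (ℕP.*-distribˡ-+ k a (b ∸ a))) (sym (ℕP.+-assoc c _ _)))
      n∣b∸a : n ∣ b ∸ a
      n∣b∸a = coprime-divisor cop (∣m+n∣m⇒∣n (subst (n ∣_) shift n∣b) n∣a)

  linear-solution-unique : ∀ {a b} → a < n → b < n → n ∣ c + k * a → n ∣ c + k * b → a ≡ b
  linear-solution-unique {a} {b} a<n b<n n∣a n∣b with ℕP.<-cmp a b
  ... | tri≈ _ a≡b _ = a≡b
  ... | tri< a<b _ _ = ⊥-elim (no-smaller-solution a<b b<n n∣a n∣b)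
  ... | tri> _ _ b<a = ⊥-elim (no-smaller-solution b<a a<n n∣b n∣a)

coprime-1 : ∀ n → Coprime n 1
coprime-1 n (_ , d∣1) = ∣1⇒≡1 d∣1

∑-divides-+ : ∀ h t → .{{NonZero h}} → ℕΣ.∑ h (λ w → 𝟙 (does (h ∣? t + w))) ≡ 1
∑-divides-+ h t = trans (ℕΣ.∑-single h _ w₀ w₀<h (λ w w<h w≢w₀ → cong 𝟙 (dec-false (h ∣? t + w) (w≢w₀ ∘ unique w<h))))
                        (cong 𝟙 (dec-true (h ∣? t + w₀) h∣t+w₀))
  where
  r = t % h
  q = t / h
  t≡r+qh : t ≡ r + q * h
  t≡r+qh = m≡m%n+[m/n]*n t h
  r<h : r < h
  r<h = m%n<n t h
  w₀ : ℕ
  w₀ with r ≟ 0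
  ... | yes _ = 0
  ... | no _  = h ∸ r
  w₀<h : w₀ < h
  w₀<h with r ≟ 0
  ... | yes _   = ℕ.>-nonZero⁻¹ h
  ... | no r≢0 = ℕP.∸-monoʳ-< (ℕP.n≢0⇒n>0 r≢0) (ℕP.<⇒≤ r<h)
  h∣t+w₀ : h ∣ t + w₀
  h∣t+w₀ with r ≟ 0
  ... | yes r≡0 = divides q (trans (ℕP.+-identityʳ t) (trans t≡r+qh (cong (_+ q * h) r≡0)))
  ... | no _    = divides (suc q) (begin
    t + (h ∸ r)             ≡⟨ cong (_+ (h ∸ r)) t≡r+qh ⟩
    r + q * h + (h ∸ r)     ≡⟨ cong (_+ (h ∸ r)) (ℕP.+-comm r (q * h)) ⟩
    q * h + r + (h ∸ r)     ≡⟨ ℕP.+-assoc (q * h) r _ ⟩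
    q * h + (r + (h ∸ r))   ≡⟨ cong (_+_ (q * h)) (ℕP.m+[n∸m]≡n (ℕP.<⇒≤ r<h)) ⟩
    q * h + h               ≡⟨ ℕP.+-comm (q * h) h ⟩
    suc q * h               ∎)
    where open ≡-Reasoning
  unique : ∀ {w} → w < h → h ∣ t + w → w ≡ w₀
  unique {w} w<h h∣t+w = linear-solution-unique h 1 t (coprime-1 h) w<h w₀<h
    (subst (λ x → h ∣ t + x) (sym (ℕP.*-identityˡ w)) h∣t+w)
    (subst (λ x → h ∣ t + x) (sym (ℕP.*-identityˡ w₀)) h∣t+w₀)

m%2≡1 : ∀ m → ¬ 2 ∣ m → m % 2 ≡ 1
m%2≡1 m 2∤m with m % 2 | m%n<n m 2 | m%n≡0⇒n∣m m 2
... | zero        | _             | 2∣m = ⊥-elim (2∤m (2∣m refl))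
... | suc zero    | _             | _   = refl
... | suc (suc _) | s≤s (s≤s ()) | _

halfCount′ : ∀ {A B : Set} → Dec A → Dec B → ℕ
halfCount′ (yes _) (yes _) = 2
halfCount′ (yes _) (no _)  = 0
halfCount′ (no _)  _       = 1

-- the number of w ∈ ℤ_n with c + 2 w ≡ 0 (mod n), see ∑-halves
halfCount : ℕ → ℕ → ℕ
halfCount n c = halfCount′ (2 ∣? n) (2 ∣? c)

module _ (n c : ℕ) .{{_ : NonZero n}} where

  ∑-halves-odd : ¬ 2 ∣ n → ℕΣ.∑ n (λ w → 𝟙 (does (n ∣? c + 2 * w))) ≡ 1
  ∑-halves-odd 2∤n = trans (ℕΣ.∑-single n (λ w → 𝟙 (does (n ∣? c + 2 * w))) w₀ w₀<n (λ w w<n w≢w₀ → cong 𝟙 (dec-false (n ∣? c + 2 * w) (w≢w₀ ∘ unique w<n))))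
                           (cong 𝟙 (dec-true (n ∣? c + 2 * w₀) n∣c+2w₀))
    where
    h = n / 2
    n≡2h+1 : n ≡ 1 + 2 * h
    n≡2h+1 = trans (m≡m%n+[m/n]*n n 2) (cong₂ _+_ (m%2≡1 n 2∤n) (ℕP.*-comm h 2))
    -- 2 h ≡ -1 (mod n), so w₀ = c h solves c + 2 w₀ ≡ 0.
    w₀ = (c * h) % n
    w₀<n : w₀ < n
    w₀<n = m%n<n (c * h) n
    n∣c+2w₀ : n ∣ c + 2 * w₀
    n∣c+2w₀ = m%n≡0⇒n∣m _ n (begin
      (c + 2 * ((c * h) % n)) % n ≡⟨ +-cong-≡ₗ n {c} {c} refl (*-congˡ-≡ₗ n 2 (%-≡ₗ n (c * h))) ⟩
      (c + 2 * (c * h)) % n      ≡⟨ cong (_% n) (trans (lemma c h) (cong (c *_) (sym n≡2h+1))) ⟩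
      (c * n) % n                ≡⟨ m*n%n≡0 c n ⟩
      0                          ∎)
      where
      open ≡-Reasoning
      lemma : ∀ c h → c + 2 * (c * h) ≡ c * (1 + 2 * h)
      lemma = solve-∀
    unique : ∀ {w} → w < n → n ∣ c + 2 * w → w ≡ w₀
    unique w<n n∣c+2w = linear-solution-unique n 2 c (prime∤⇒coprime prime[2] 2∤n) w<n w₀<n n∣c+2w n∣c+2w₀

  ∑-halves-even-odd : 2 ∣ n → ¬ 2 ∣ c → ℕΣ.∑ n (λ w → 𝟙 (does (n ∣? c + 2 * w))) ≡ 0
  ∑-halves-even-odd 2∣n 2∤c = ℕΣ.∑-zero n (λ w _ → cong 𝟙 (dec-false (n ∣? c + 2 * w) (2∤c ∘ 2∣c w)))
    where
    2∣c : ∀ w → n ∣ c + 2 * w → 2 ∣ c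
    2∣c w n∣ = ∣m+n∣m⇒∣n (subst (2 ∣_) (ℕP.+-comm c (2 * w)) (∣-trans 2∣n n∣)) (m∣m*n w)

  -- With n = 2 h and c = 2 c′ the condition is h ∣ c′ + w, met once in each half of [0, n).
  ∑-halves-even-even : 2 ∣ n → 2 ∣ c → ℕΣ.∑ n (λ w → 𝟙 (does (n ∣? c + 2 * w))) ≡ 2
  ∑-halves-even-even (divides h n≡h2) (divides c′ c≡c′2) = begin
    ℕΣ.∑ n (λ w → 𝟙 (does (n ∣? c + 2 * w)))
      ≡⟨ ℕΣ.∑-cong n (λ w _ → cong 𝟙 (does-⇔ (mk⇔ halve double) (n ∣? c + 2 * w) (h ∣? c′ + w))) ⟩
    ℕΣ.∑ n f′
      ≡⟨ cong (λ m → ℕΣ.∑ m f′) n≡h+h ⟩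
    ℕΣ.∑ (h + h) f′
      ≡⟨ ℕΣ.∑-split h h f′ ⟩
    ℕΣ.∑ h f′ + ℕΣ.∑ h (λ w → f′ (h + w))
      ≡⟨ cong₂ _+_ (∑-divides-+ h c′) (trans (ℕΣ.∑-cong h (λ w _ → cong (λ x → 𝟙 (does (h ∣? x))) (sym (ℕP.+-assoc c′ h w))))
                                             (∑-divides-+ h (c′ + h))) ⟩
    2 ∎
    where
    open ≡-Reasoning
    instance _ = ℕ.≢-nonZero λ { refl → ℕ.≢-nonZero⁻¹ n n≡h2 }
    f′ = λ w → 𝟙 (does (h ∣? c′ + w))
    n≡h+h : n ≡ h + h
    n≡h+h = trans n≡h2 (trans (ℕP.*-comm h 2) (cong (_+_ h) (ℕP.+-identityʳ h)))
    c+2w≡ : ∀ w → c + 2 * w ≡ (c′ + w) * 2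
    c+2w≡ w = trans (cong (_+ 2 * w) c≡c′2) (trans (cong (_+_ (c′ * 2)) (ℕP.*-comm 2 w)) (sym (ℕP.*-distribʳ-+ 2 c′ w)))
    halve : ∀ {w} → n ∣ c + 2 * w → h ∣ c′ + w
    halve {w} n∣ = *-cancelʳ-∣ 2 (subst₂ _∣_ n≡h2 (c+2w≡ w) n∣)
    double : ∀ {w} → h ∣ c′ + w → n ∣ c + 2 * w
    double {w} h∣ = subst₂ _∣_ (sym n≡h2) (sym (c+2w≡ w)) (*-monoˡ-∣ 2 h∣)

  ∑-halves : ℕΣ.∑ n (λ w → 𝟙 (does (n ∣? c + 2 * w))) ≡ halfCount n c
  ∑-halves = by-parity (2 ∣? n) (2 ∣? c)
    where
    by-parity : (2∣n? : Dec (2 ∣ n)) (2∣c? : Dec (2 ∣ c)) → ℕΣ.∑ n (λ w → 𝟙 (does (n ∣? c + 2 * w))) ≡ halfCount′ 2∣n? 2∣c?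
    by-parity (no 2∤n)  (yes _)   = ∑-halves-odd 2∤n
    by-parity (no 2∤n)  (no _)    = ∑-halves-odd 2∤n
    by-parity (yes 2∣n) (no 2∤c)  = ∑-halves-even-odd 2∣n 2∤c
    by-parity (yes 2∣n) (yes 2∣c) = ∑-halves-even-even 2∣n 2∣c

halfCount-cong : ∀ n c c′ → (2 ∣ n → c % 2 ≡ c′ % 2) → halfCount n c ≡ halfCount n c′
halfCount-cong n c c′ same-parity with 2 ∣? n
... | no _    = refl
... | yes 2∣n = cong-parity (2 ∣? c) (2 ∣? c′)
  where
  transfer : ∀ {a b} → a % 2 ≡ b % 2 → 2 ∣ a → 2 ∣ b
  transfer {a} {b} a≡b 2∣a = m%n≡0⇒n∣m b 2 (trans (sym a≡b) (n∣m⇒m%n≡0 a 2 2∣a))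
  cong-parity : (2∣c? : Dec (2 ∣ c)) (2∣c′? : Dec (2 ∣ c′)) → halfCount′ (yes 2∣n) 2∣c? ≡ halfCount′ (yes 2∣n) 2∣c′?
  cong-parity (yes _)    (yes _)     = refl
  cong-parity (yes 2∣c)  (no 2∤c′)   = ⊥-elim (2∤c′ (transfer (same-parity 2∣n) 2∣c))
  cong-parity (no 2∤c)   (yes 2∣c′)  = ⊥-elim (2∤c (transfer (sym (same-parity 2∣n)) 2∣c′))
  cong-parity (no _)     (no _)      = refl

halfCount-+2* : ∀ n c w → halfCount n (c + 2 * w) ≡ halfCount n c
halfCount-+2* n c w = halfCount-cong n (c + 2 * w) c
  (λ _ → trans (cong (λ t → (c + t) % 2) (ℕP.*-comm 2 w)) ([m+kn]%n≡m%n c w 2))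

φ-∑ : ∀ m → ℕΣ.∑ m (λ u → 𝟙 (does (gcd u m ≟ 1))) ≡ φ m
φ-∑ m = begin
  ℕΣ.∑ m f
    ≡⟨ ℕP.+-cancelʳ-≡ (f m) _ _ rotate ⟩
  ℕΣ.∑ m (f ∘ suc)
    ≡⟨ sym (ℕΣ.∑ˡ-applyUpTo m (λ a → 𝟙 (gcd a m ℕ.≡ᵇ 1)) suc) ⟩
  ℕΣ.∑ˡ (List.map (λ a → 𝟙 (gcd a m ℕ.≡ᵇ 1)) (List.applyUpTo suc m))
    ≡⟨ cong (λ xs → ℕΣ.∑ˡ (List.map (λ a → 𝟙 (gcd a m ℕ.≡ᵇ 1)) xs)) (sym (ListP.map-upTo suc m)) ⟩
  ℕΣ.∑ˡ (List.map (λ a → 𝟙 (gcd a m ℕ.≡ᵇ 1)) (List.map suc (upTo m)))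
    ≡⟨ sym (length-filterᵇ (λ a → gcd a m ℕ.≡ᵇ 1) (List.map suc (upTo m))) ⟩
  φ m ∎
  where
  open ≡-Reasoning
  f = λ u → 𝟙 (does (gcd u m ≟ 1))
  -- φ counts 1 ≤ u ≤ m while ∑ counts 0 ≤ u < m; the end points agree since gcd 0 m = m = gcd m m.
  f0≡fm : f 0 ≡ f m
  f0≡fm = cong (λ x → 𝟙 (does (x ≟ 1))) (trans (gcd-identityˡ m) (sym (gcd-idem m)))
    where
    gcd-idem : ∀ m → gcd m m ≡ m
    gcd-idem m = ∣-antisym (gcd[m,n]∣m m m) (gcd-greatest ∣-refl ∣-refl)
  rotate : ℕΣ.∑ m f + f m ≡ ℕΣ.∑ m (f ∘ suc) + f m
  rotate = trans (sym (ℕΣ.∑-last m f)) (trans (cong (_+ ℕΣ.∑ m (f ∘ suc)) f0≡fm) (ℕP.+-comm (f m) _))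

-- The elements of order m are the (n / m) u with u a unit mod m.
∑-order : ∀ n m → .{{NonZero n}} → .{{NonZero m}} →
          ℕΣ.∑ n (λ w → 𝟙 (does ((gcd w n * m) ≟ n))) ≡ ℕΣ.when (does (m ∣? n)) (φ m)
∑-order n m = count (m ∣? n)
  where
  F = λ w → 𝟙 (does ((gcd w n * m) ≟ n))
  count : (m∣n? : Dec (m ∣ n)) → ℕΣ.∑ n F ≡ ℕΣ.when (does m∣n?) (φ m)
  count (no m∤n) = ℕΣ.∑-zero n (λ w _ → cong 𝟙 (dec-false ((gcd w n * m) ≟ n) (λ e → m∤n (divides (gcd w n) (sym e)))))
  count (yes (divides d n≡dm)) = begin
    ℕΣ.∑ n F                                   ≡⟨ ℕΣ.∑-cong n (λ w _ → only-multiples w) ⟩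
    ℕΣ.∑ n (λ w → ℕΣ.when (does (d ∣? w)) (F w)) ≡⟨ cong (λ N → ℕΣ.∑ N (λ w → ℕΣ.when (does (d ∣? w)) (F w))) n≡dm ⟩
    ℕΣ.∑ (d * m) (λ w → ℕΣ.when (does (d ∣? w)) (F w)) ≡⟨ ℕΣ.∑-multiples d m F ⟩
    ℕΣ.∑ m (λ u → F (d * u))
      ≡⟨ ℕΣ.∑-cong m (λ u _ → cong 𝟙 (does-⇔ (mk⇔ (to u) (from u)) ((gcd (d * u) n * m) ≟ n) (gcd u m ≟ 1))) ⟩
    ℕΣ.∑ m (λ u → 𝟙 (does (gcd u m ≟ 1)))   ≡⟨ φ-∑ m ⟩
    φ m                                        ∎
    where
    open ≡-Reasoning
    instance _ = ℕ.≢-nonZero λ { refl → ℕ.≢-nonZero⁻¹ n n≡dm }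
    gcd≡d : ∀ w → gcd w n * m ≡ n → gcd w n ≡ d
    gcd≡d w e = ℕP.*-cancelʳ-≡ _ _ m (trans e n≡dm)
    guard : ∀ {P Q : Set} (P? : Dec P) (Q? : Dec Q) → (Q → P) → 𝟙 (does Q?) ≡ ℕΣ.when (does P?) (𝟙 (does Q?))
    guard (yes _) Q?      _   = refl
    guard (no ¬p) (yes q) q⇒p = ⊥-elim (¬p (q⇒p q))
    guard (no _)  (no _)  _   = refl
    only-multiples : ∀ w → F w ≡ ℕΣ.when (does (d ∣? w)) (F w)
    only-multiples w = guard (d ∣? w) ((gcd w n * m) ≟ n) (λ order → subst (_∣ w) (gcd≡d w order) (gcd[m,n]∣m w n))
    gcd-d* : ∀ u → gcd (d * u) n ≡ d * gcd u m
    gcd-d* u = trans (cong (gcd (d * u)) n≡dm) (sym (c*gcd[m,n]≡gcd[cm,cn] d u m))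
    to : ∀ u → gcd (d * u) n * m ≡ n → gcd u m ≡ 1
    to u e = ℕP.*-cancelˡ-≡ (gcd u m) 1 d
               (trans (ℕP.*-cancelʳ-≡ _ _ m (trans (cong (_* m) (sym (gcd-d* u))) (trans e n≡dm))) (sym (ℕP.*-identityʳ d)))
    from : ∀ u → gcd u m ≡ 1 → gcd (d * u) n * m ≡ n
    from u e = trans (cong (_* m) (trans (gcd-d* u) (trans (cong (d *_) e) (ℕP.*-identityʳ d)))) (sym n≡dm)

-- gcd(w, n) = n / m, and 2 ∣ w ⇔ 2 ∣ gcd(w, n) as 2 ∣ n.
order-parity : ∀ w n m → .{{NonZero m}} → 2 ∣ n → gcd w n * m ≡ n → w % 2 ≡ (n ÷ m) % 2
order-parity w n m 2∣n order = parity (2 ∣? w)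
  where
  n÷m≡gcd : n ÷ m ≡ gcd w n
  n÷m≡gcd = ÷-≡ n m (gcd w n) (trans (ℕP.*-comm m (gcd w n)) order)
  parity : Dec (2 ∣ w) → w % 2 ≡ (n ÷ m) % 2
  parity (yes 2∣w) = trans (n∣m⇒m%n≡0 w 2 2∣w)
                           (sym (n∣m⇒m%n≡0 (n ÷ m) 2 (subst (2 ∣_) (sym n÷m≡gcd) (gcd-greatest 2∣w 2∣n))))
  parity (no 2∤w)  = trans (m%2≡1 w 2∤w)
                           (sym (m%2≡1 (n ÷ m) (λ 2∣n÷m → 2∤w (∣-trans (subst (2 ∣_) n÷m≡gcd 2∣n÷m) (gcd[m,n]∣m w n)))))

-- Σ_i n / m_i, whose parity decides whether the relation can be solved (see halfCount)
quotientSum : ∀ {r} → Vec ℕ r → ℕ → ℕ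
quotientSum []       n = 0
quotientSum (m ∷ ms) n = n ÷ m + quotientSum ms n

orderCount : ∀ {r} → Vec ℕ r → ℕ → ℕ
orderCount []       n = 1
orderCount (m ∷ ms) n = ℕΣ.when (does (m ∣? n)) (φ m) * orderCount ms n

-- Counting inside the subgroup e ℤ_l ≅ ℤ_n′ of ℤ_l, l = e n′.
module _ (l e n′ : ℕ) .{{_ : NonZero l}} .{{_ : NonZero e}} .{{_ : NonZero n′}} (en′≡l : e * n′ ≡ l) where

  l∣e*⇒n′∣ : ∀ a → l ∣ e * a → n′ ∣ a
  l∣e*⇒n′∣ a l∣ea = *-cancelˡ-∣ e (subst (_∣ e * a) (sym en′≡l) l∣ea)

  n′∣⇒l∣e* : ∀ a → n′ ∣ a → l ∣ e * a
  n′∣⇒l∣e* a n′∣a = subst (_∣ e * a) en′≡l (*-monoʳ-∣ e n′∣a)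

  ∑-multiples-of-e : ∀ (f : ℕ → ℕ) → ℕΣ.∑ l (λ j → ℕΣ.when (does (e ∣? j)) (f j)) ≡ ℕΣ.∑ n′ (λ w → f (e * w))
  ∑-multiples-of-e f = trans (cong (λ N → ℕΣ.∑ N (λ j → ℕΣ.when (does (e ∣? j)) (f j))) (sym en′≡l))
                             (ℕΣ.∑-multiples e n′ f)

  relationSolutions : ℕ → ℕ → ℕ
  relationSolutions g c′ = ℕΣ.∑ᵛ l g (λ z → 𝟙 (dividesAllᵇ l e z) * 𝟙 (does (l ∣? e * c′ + 2 * vsum z)))

  relationSolutions-zero : ∀ c′ → relationSolutions 0 c′ ≡ 𝟙 (does (n′ ∣? c′))
  relationSolutions-zero c′ = trans (ℕP.+-identityʳ _)
    (cong 𝟙 (does-⇔ (mk⇔ (l∣e*⇒n′∣ c′ ∘ subst (l ∣_) e*c′+0≡e*c′) (subst (l ∣_) (sym e*c′+0≡e*c′) ∘ n′∣⇒l∣e* c′))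
                    (l ∣? e * c′ + 2 * 0) (n′ ∣? c′)))
    where
    e*c′+0≡e*c′ : e * c′ + 2 * 0 ≡ e * c′
    e*c′+0≡e*c′ = ℕP.+-identityʳ (e * c′)

  relationSolutions-suc : ∀ g c′ → relationSolutions (suc g) c′ ≡ ℕΣ.∑ n′ (λ w → relationSolutions g (c′ + 2 * w))
  relationSolutions-suc g c′ = begin
    relationSolutions (suc g) c′
      ≡⟨ ℕΣ.∑ᵛ-head l g (λ z → 𝟙 (dividesAllᵇ l e z) * 𝟙 (does (l ∣? e * c′ + 2 * vsum z)))
                       (λ j → ℕΣ.when (does (e ∣? j)) (rest j))
                       (λ x → trans (ℕΣ.∑ᵛ-cong l g (λ v → 𝟙-∧-* (does (e ∣? toℕ x)) (dividesAllᵇ l e v)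
                                                                 (𝟙 (does (l ∣? e * c′ + 2 * (toℕ x + vsum v))))))
                                    (ℕΣ.∑ᵛ-when l g (does (e ∣? toℕ x)) _)) ⟩
    ℕΣ.∑ l (λ j → ℕΣ.when (does (e ∣? j)) (rest j))
      ≡⟨ ∑-multiples-of-e rest ⟩
    ℕΣ.∑ n′ (λ w → rest (e * w))
      ≡⟨ ℕΣ.∑-cong n′ (λ w _ → ℕΣ.∑ᵛ-cong l g (λ v → cong (λ t → 𝟙 (dividesAllᵇ l e v) * 𝟙 (does (l ∣? t))) (regroup e c′ w (vsum v)))) ⟩
    ℕΣ.∑ n′ (λ w → relationSolutions g (c′ + 2 * w)) ∎
    where
    open ≡-Reasoning
    rest : ℕ → ℕ
    rest j = ℕΣ.∑ᵛ l g (λ v → 𝟙 (dividesAllᵇ l e v) * 𝟙 (does (l ∣? e * c′ + 2 * (j + vsum v))))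
    regroup : ∀ e c′ w s → e * c′ + 2 * (e * w + s) ≡ e * (c′ + 2 * w) + 2 * s
    regroup = solve-∀

  relationSolutions-count : ∀ g c′ → relationSolutions (suc g) c′ ≡ n′ ^ g * halfCount n′ c′
  relationSolutions-count zero c′ = begin
    relationSolutions 1 c′                                  ≡⟨ relationSolutions-suc 0 c′ ⟩
    ℕΣ.∑ n′ (λ w → relationSolutions 0 (c′ + 2 * w))        ≡⟨ ℕΣ.∑-cong n′ (λ w _ → relationSolutions-zero (c′ + 2 * w)) ⟩
    ℕΣ.∑ n′ (λ w → 𝟙 (does (n′ ∣? c′ + 2 * w)))             ≡⟨ ∑-halves n′ c′ ⟩
    halfCount n′ c′                                         ≡⟨ sym (ℕP.*-identityˡ _) ⟩
    n′ ^ 0 * halfCount n′ c′                                ∎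
    where open ≡-Reasoning
  relationSolutions-count (suc g) c′ = begin
    relationSolutions (suc (suc g)) c′                      ≡⟨ relationSolutions-suc (suc g) c′ ⟩
    ℕΣ.∑ n′ (λ w → relationSolutions (suc g) (c′ + 2 * w))
      ≡⟨ ℕΣ.∑-cong n′ (λ w _ → trans (relationSolutions-count g (c′ + 2 * w)) (cong (n′ ^ g *_) (halfCount-+2* n′ c′ w))) ⟩
    ℕΣ.∑ n′ (λ _ → n′ ^ g * halfCount n′ c′)                ≡⟨ ℕ∑-const n′ _ ⟩
    n′ * (n′ ^ g * halfCount n′ c′)                         ≡⟨ sym (ℕP.*-assoc n′ _ _) ⟩
    n′ ^ suc g * halfCount n′ c′                            ∎
    where open ≡-Reasoning

  -- y_i = e w_i with w_i of order m_i in ℤ_n′, so for even n′ it has the parity of n′ / m_i (order-parity).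
  vsum-hasOrders : ∀ {r} (ms : Vec ℕ r) (y : Vec (Fin l) r) → T (dividesAllᵇ l e y ∧ hasOrdersᵇ l ms y) →
                   ∃ λ c′ → vsum y ≡ e * c′ × (2 ∣ n′ → c′ % 2 ≡ quotientSum ms n′ % 2)
  vsum-hasOrders []       []      _ = 0 , sym (ℕP.*-zeroʳ e) , λ _ → refl
  vsum-hasOrders (m ∷ ms) (x ∷ y) t
    with vsum-hasOrders ms y (T-∧⁺ (T-∧₂ {does (e ∣? toℕ x)} (T-∧₁ t))
                                   (T-∧₂ {does ((gcd (toℕ x) l * m) ≟ l)} (T-∧₂ {does (e ∣? toℕ x) ∧ dividesAllᵇ l e y} t)))
       | T-does (e ∣? toℕ x) (T-∧₁ (T-∧₁ t))
  ... | c″ , vsum-y≡ec″ , parity | divides w x≡we =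
    w + c″ , vsum≡ , λ 2∣n′ → +-cong-≡ₗ 2 {w} {n′ ÷ m} {c″} {quotientSum ms n′} (order-parity w n′ m 2∣n′ order-in-ℤn′) (parity 2∣n′)
    where
    order : gcd (toℕ x) l * m ≡ l
    order = T-does ((gcd (toℕ x) l * m) ≟ l) (T-∧₁ (T-∧₂ {does (e ∣? toℕ x) ∧ dividesAllᵇ l e y} t))
    instance _ = ℕ.≢-nonZero λ { refl → ℕ.≢-nonZero⁻¹ l (trans (sym order) (ℕP.*-zeroʳ (gcd (toℕ x) l))) }
    vsum≡ : toℕ x + vsum y ≡ e * (w + c″)
    vsum≡ = trans (cong₂ _+_ (trans x≡we (ℕP.*-comm w e)) vsum-y≡ec″) (sym (ℕP.*-distribˡ-+ e w c″))
    order-in-ℤn′ : gcd w n′ * m ≡ n′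
    order-in-ℤn′ = ℕP.*-cancelˡ-≡ _ _ e (begin
      e * (gcd w n′ * m)       ≡⟨ sym (ℕP.*-assoc e _ m) ⟩
      e * gcd w n′ * m         ≡⟨ cong (_* m) (c*gcd[m,n]≡gcd[cm,cn] e w n′) ⟩
      gcd (e * w) (e * n′) * m ≡⟨ cong₂ (λ u v → gcd u v * m) (trans (ℕP.*-comm e w) (sym x≡we)) en′≡l ⟩
      gcd (toℕ x) l * m        ≡⟨ order ⟩
      l                        ≡⟨ sym en′≡l ⟩
      e * n′                   ∎)
      where open ≡-Reasoning

  ∑-order-in-eℤ : ∀ m → ℕΣ.∑ l (λ j → 𝟙 (does (e ∣? j) ∧ does ((gcd j l * m) ≟ l))) ≡ ℕΣ.when (does (m ∣? n′)) (φ m)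
  ∑-order-in-eℤ zero = trans (ℕΣ.∑-zero l (λ j _ → no-order-0 j)) (sym (ℕΣ.when-ε (does (0 ∣? n′))))
    where
    no-order-0 : ∀ j → 𝟙 (does (e ∣? j) ∧ does ((gcd j l * 0) ≟ l)) ≡ 0
    no-order-0 j = trans (cong (λ b → 𝟙 (does (e ∣? j) ∧ b)) (dec-false ((gcd j l * 0) ≟ l) gcd*0≢l))
                         (cong 𝟙 (𝔹P.∧-zeroʳ (does (e ∣? j))))
      where
      gcd*0≢l : gcd j l * 0 ≢ l
      gcd*0≢l 0≡l = ℕ.≢-nonZero⁻¹ l (trans (sym 0≡l) (ℕP.*-zeroʳ (gcd j l)))
  ∑-order-in-eℤ m@(suc _) = begin
    ℕΣ.∑ l (λ j → 𝟙 (does (e ∣? j) ∧ does ((gcd j l * m) ≟ l)))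
      ≡⟨ ℕΣ.∑-cong l (λ j _ → 𝟙-∧-when (does (e ∣? j)) (does ((gcd j l * m) ≟ l))) ⟩
    ℕΣ.∑ l (λ j → ℕΣ.when (does (e ∣? j)) (𝟙 (does ((gcd j l * m) ≟ l))))
      ≡⟨ ∑-multiples-of-e (λ j → 𝟙 (does ((gcd j l * m) ≟ l))) ⟩
    ℕΣ.∑ n′ (λ w → 𝟙 (does ((gcd (e * w) l * m) ≟ l)))
      ≡⟨ ℕΣ.∑-cong n′ (λ w _ → cong 𝟙 (does-⇔ (mk⇔ (to w) (from w)) ((gcd (e * w) l * m) ≟ l) ((gcd w n′ * m) ≟ n′))) ⟩
    ℕΣ.∑ n′ (λ w → 𝟙 (does ((gcd w n′ * m) ≟ n′)))
      ≡⟨ ∑-order n′ m ⟩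
    ℕΣ.when (does (m ∣? n′)) (φ m) ∎
    where
    open ≡-Reasoning
    gcd-e* : ∀ w → gcd (e * w) l * m ≡ e * (gcd w n′ * m)
    gcd-e* w = trans (cong (λ t → gcd (e * w) t * m) (sym en′≡l))
                     (trans (cong (_* m) (sym (c*gcd[m,n]≡gcd[cm,cn] e w n′))) (ℕP.*-assoc e _ m))
    to : ∀ w → gcd (e * w) l * m ≡ l → gcd w n′ * m ≡ n′
    to w order = ℕP.*-cancelˡ-≡ _ _ e (trans (sym (gcd-e* w)) (trans order (sym en′≡l)))
    from : ∀ w → gcd w n′ * m ≡ n′ → gcd (e * w) l * m ≡ l
    from w order = trans (gcd-e* w) (trans (cong (e *_) order) en′≡l)

  ∑ᵛ-hasOrders : ∀ {r} (ms : Vec ℕ r) → ℕΣ.∑ᵛ l r (λ y → 𝟙 (dividesAllᵇ l e y ∧ hasOrdersᵇ l ms y)) ≡ orderCount ms n′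
  ∑ᵛ-hasOrders []               = refl
  ∑ᵛ-hasOrders {suc r} (m ∷ ms) = begin
    ℕΣ.∑ᵛ l (suc r) (λ y → 𝟙 (dividesAllᵇ l e y ∧ hasOrdersᵇ l (m ∷ ms) y))
      ≡⟨ ℕΣ.∑ᵛ-head l r (λ y → 𝟙 (dividesAllᵇ l e y ∧ hasOrdersᵇ l (m ∷ ms) y))
                       (λ j → 𝟙 (e∣ j ∧ hasOrder j) * orderCount ms n′) split-head ⟩
    ℕΣ.∑ l (λ j → 𝟙 (e∣ j ∧ hasOrder j) * orderCount ms n′)
      ≡⟨ ℕΣ.∑-distribʳ-⊗ l (λ j → 𝟙 (e∣ j ∧ hasOrder j)) (orderCount ms n′) ⟩
    ℕΣ.∑ l (λ j → 𝟙 (e∣ j ∧ hasOrder j)) * orderCount ms n′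
      ≡⟨ cong (_* orderCount ms n′) (∑-order-in-eℤ m) ⟩
    orderCount (m ∷ ms) n′ ∎
    where
    open ≡-Reasoning
    e∣ = λ j → does (e ∣? j)
    hasOrder = λ j → does ((gcd j l * m) ≟ l)
    interchange : ∀ a b c d → 𝟙 ((a ∧ b) ∧ (c ∧ d)) ≡ 𝟙 (a ∧ c) * 𝟙 (b ∧ d)
    interchange true  b true  d = sym (ℕP.+-identityʳ _)
    interchange true  b false d = cong 𝟙 (𝔹P.∧-zeroʳ b)
    interchange false b c     d = refl
    split-head : ∀ x → ℕΣ.∑ᵛ l r (λ v → 𝟙 (dividesAllᵇ l e (x ∷ v) ∧ hasOrdersᵇ l (m ∷ ms) (x ∷ v)))
                       ≡ 𝟙 (e∣ (toℕ x) ∧ hasOrder (toℕ x)) * orderCount ms n′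
    split-head x = begin
      ℕΣ.∑ᵛ l r (λ v → 𝟙 ((e∣ (toℕ x) ∧ dividesAllᵇ l e v) ∧ (hasOrder (toℕ x) ∧ hasOrdersᵇ l ms v)))
        ≡⟨ ℕΣ.∑ᵛ-cong l r (λ v → interchange (e∣ (toℕ x)) (dividesAllᵇ l e v) (hasOrder (toℕ x)) (hasOrdersᵇ l ms v)) ⟩
      ℕΣ.∑ᵛ l r (λ v → 𝟙 (e∣ (toℕ x) ∧ hasOrder (toℕ x)) * 𝟙 (dividesAllᵇ l e v ∧ hasOrdersᵇ l ms v))
        ≡⟨ ℕΣ.∑ᵛ-distribˡ-⊗ l r (𝟙 (e∣ (toℕ x) ∧ hasOrder (toℕ x))) (λ v → 𝟙 (dividesAllᵇ l e v ∧ hasOrdersᵇ l ms v)) ⟩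
      𝟙 (e∣ (toℕ x) ∧ hasOrder (toℕ x)) * ℕΣ.∑ᵛ l r (λ v → 𝟙 (dividesAllᵇ l e v ∧ hasOrdersᵇ l ms v))
        ≡⟨ cong (𝟙 (e∣ (toℕ x) ∧ hasOrder (toℕ x)) *_) (∑ᵛ-hasOrders ms) ⟩
      𝟙 (e∣ (toℕ x) ∧ hasOrder (toℕ x)) * orderCount ms n′ ∎

  homsInto-count : ∀ {r} g (ms : Vec ℕ r) →
                   homsInto l (suc g) ms e ≡ orderCount ms n′ * (n′ ^ g * halfCount n′ (quotientSum ms n′))
  homsInto-count {r} g ms = begin
    homsInto l (suc g) ms e
      ≡⟨ ℕΣ.∑ᵛ-cong l r (λ y → trans (ℕΣ.∑ᵛ-cong l (suc g) (λ z → regroup (dividesAllᵇ l e y) (hasOrdersᵇ l ms y) (dividesAllᵇ l e z)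
                                                                          (𝟙 (does (l ∣? relationSum l y z)))))
                                     (ℕΣ.∑ᵛ-distribˡ-⊗ l (suc g) (𝟙 (dividesAllᵇ l e y ∧ hasOrdersᵇ l ms y)) (zPart y))) ⟩
    ℕΣ.∑ᵛ l r (λ y → 𝟙 (dividesAllᵇ l e y ∧ hasOrdersᵇ l ms y) * ℕΣ.∑ᵛ l (suc g) (zPart y))
      ≡⟨ ℕΣ.∑ᵛ-cong l r (λ y → 𝟙-guard (dividesAllᵇ l e y ∧ hasOrdersᵇ l ms y) (count-z y)) ⟩
    ℕΣ.∑ᵛ l r (λ y → 𝟙 (dividesAllᵇ l e y ∧ hasOrdersᵇ l ms y) * K)
      ≡⟨ ℕΣ.∑ᵛ-cong l r (λ y → ℕP.*-comm _ K) ⟩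
    ℕΣ.∑ᵛ l r (λ y → K * 𝟙 (dividesAllᵇ l e y ∧ hasOrdersᵇ l ms y))
      ≡⟨ ℕΣ.∑ᵛ-distribˡ-⊗ l r K (λ y → 𝟙 (dividesAllᵇ l e y ∧ hasOrdersᵇ l ms y)) ⟩
    K * ℕΣ.∑ᵛ l r (λ y → 𝟙 (dividesAllᵇ l e y ∧ hasOrdersᵇ l ms y))
      ≡⟨ cong (K *_) (∑ᵛ-hasOrders ms) ⟩
    K * orderCount ms n′
      ≡⟨ ℕP.*-comm K _ ⟩
    orderCount ms n′ * K ∎
    where
    open ≡-Reasoning
    K = n′ ^ g * halfCount n′ (quotientSum ms n′)
    zPart : Vec (Fin l) r → Vec (Fin l) (suc g) → ℕ
    zPart y z = 𝟙 (dividesAllᵇ l e z) * 𝟙 (does (l ∣? relationSum l y z))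
    regroup : ∀ a b c L → 𝟙 (a ∧ c) * (L * 𝟙 b) ≡ 𝟙 (a ∧ b) * (𝟙 c * L)
    regroup a b c L = trans (cong (_* (L * 𝟙 b)) (𝟙-∧ a c))
                            (trans (lemma (𝟙 a) (𝟙 b) (𝟙 c) L) (cong (_* (𝟙 c * L)) (sym (𝟙-∧ a b))))
      where
      lemma : ∀ x y z L → x * z * (L * y) ≡ x * y * (z * L)
      lemma = solve-∀
    𝟙-guard : ∀ b {X Y : ℕ} → (T b → X ≡ Y) → 𝟙 b * X ≡ 𝟙 b * Y
    𝟙-guard true  X≡Y = cong (_+ 0) (X≡Y tt)
    𝟙-guard false _   = refl
    count-z : ∀ y → T (dividesAllᵇ l e y ∧ hasOrdersᵇ l ms y) → ℕΣ.∑ᵛ l (suc g) (zPart y) ≡ K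
    count-z y t with vsum-hasOrders ms y t
    ... | c′ , vsum-y≡ec′ , parity = begin
      ℕΣ.∑ᵛ l (suc g) (zPart y)
        ≡⟨ ℕΣ.∑ᵛ-cong l (suc g) (λ z → cong (λ u → 𝟙 (dividesAllᵇ l e z) * 𝟙 (does (l ∣? u + 2 * vsum z))) vsum-y≡ec′) ⟩
      relationSolutions (suc g) c′
        ≡⟨ relationSolutions-count g c′ ⟩
      n′ ^ g * halfCount n′ c′
        ≡⟨ cong (n′ ^ g *_) (halfCount-cong n′ c′ (quotientSum ms n′) parity) ⟩
      K ∎

-- The denominator b and m′

↥-/-cross : ∀ i n .{{_ : NonZero n}} → ↥ (i ℚ./ n) ℤ.* + n ≡ i ℤ.* ↧ (i ℚ./ n)
↥-/-cross i n = begin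
  ↥ x ℤ.* + n         ≡⟨ cong (↥ x ℤ.*_) (sym (ℚP.↧-/ i n)) ⟩
  ↥ x ℤ.* (↧ x ℤ.* g) ≡⟨ lemma (↥ x) (↧ x) g ⟩
  (↥ x ℤ.* g) ℤ.* ↧ x ≡⟨ cong (ℤ._* ↧ x) (ℚP.↥-/ i n) ⟩
  i ℤ.* ↧ x           ∎
  where
  open ≡-Reasoning
  x = i ℚ./ n
  g = ℤGCD.gcd i (+ n)
  lemma : ∀ a b c → a ℤ.* (b ℤ.* c) ≡ (a ℤ.* c) ℤ.* b
  lemma = ℤSolver.solve-∀

↥-+-cross : ∀ p q → ↥ (p ℚ.+ q) ℤ.* (↧ p ℤ.* ↧ q) ≡ (↥ p ℤ.* ↧ q ℤ.+ ↥ q ℤ.* ↧ p) ℤ.* ↧ (p ℚ.+ q)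
↥-+-cross p@(mkℚ pn pd _) q@(mkℚ qn qd _) =
  trans (cong (↥ (p ℚ.+ q) ℤ.*_) (sym (ℤP.pos-* (suc pd) (suc qd))))
        (↥-/-cross (pn ℤ.* + suc qd ℤ.+ qn ℤ.* + suc pd) (suc pd * suc qd))

-- T / N is a (not necessarily reduced) representation of x
Fraction : ℚ → ℕ → ℕ → Set
Fraction x T N = ↥ x ℤ.* + N ≡ + T ℤ.* ↧ x

Fraction-inv2-+ : ∀ m₀ q x T → Fraction x T (2 * (q * suc m₀)) →
                  Fraction (inv2 (suc m₀) ℚ.+ x) (q + T) (2 * (q * suc m₀))
Fraction-inv2-+ m₀ q x T x≐T/N = ℤP.*-cancelʳ-≡ _ _ (Da ℤ.* Dx) {{Da*Dx≢0}} (begin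
  S ℤ.* + N ℤ.* (Da ℤ.* Dx)
    ≡⟨ ringA S Da Dx (+ N) ⟩
  (S ℤ.* (Da ℤ.* Dx)) ℤ.* + N
    ≡⟨ cong (ℤ._* + N) (↥-+-cross a x) ⟩
  (A ℤ.* Dx ℤ.+ X ℤ.* Da) ℤ.* Ds ℤ.* + N
    ≡⟨ cong ((A ℤ.* Dx ℤ.+ X ℤ.* Da) ℤ.* Ds ℤ.*_) +N≡ ⟩
  (A ℤ.* Dx ℤ.+ X ℤ.* Da) ℤ.* Ds ℤ.* (+ 2 ℤ.* (+ q ℤ.* + m))
    ≡⟨ ringB A Dx X Da Ds (+ q) (+ m) ⟩
  Ds ℤ.* (Dx ℤ.* + q ℤ.* (A ℤ.* (+ 2 ℤ.* + m)) ℤ.+ Da ℤ.* (X ℤ.* (+ 2 ℤ.* (+ q ℤ.* + m))))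
    ≡⟨ cong₂ (λ u v → Ds ℤ.* (Dx ℤ.* + q ℤ.* u ℤ.+ Da ℤ.* v)) a≐1/2m (trans (cong (X ℤ.*_) (sym +N≡)) x≐T/N) ⟩
  Ds ℤ.* (Dx ℤ.* + q ℤ.* (+ 1 ℤ.* Da) ℤ.+ Da ℤ.* (+ T ℤ.* Dx))
    ≡⟨ ringC Ds Dx (+ q) Da (+ T) ⟩
  (+ q ℤ.+ + T) ℤ.* Ds ℤ.* (Da ℤ.* Dx)
    ≡⟨ cong (λ u → u ℤ.* Ds ℤ.* (Da ℤ.* Dx)) (sym (ℤP.pos-+ q T)) ⟩
  + (q + T) ℤ.* Ds ℤ.* (Da ℤ.* Dx) ∎)
  where
  open ≡-Reasoning
  m = suc m₀
  N = 2 * (q * m)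
  a = inv2 m
  A = ↥ a
  Da = ↧ a
  X = ↥ x
  Dx = ↧ x
  S = ↥ (a ℚ.+ x)
  Ds = ↧ (a ℚ.+ x)
  Da*Dx≢0 : ℤ.NonZero (Da ℤ.* Dx)
  Da*Dx≢0 = ℤ.≢-nonZero λ e → ℕ.≢-nonZero⁻¹ (↧ₙ a * ↧ₙ x) (ℤP.+-injective (trans (ℤP.pos-* (↧ₙ a) (↧ₙ x)) e))
  +N≡ : + N ≡ + 2 ℤ.* (+ q ℤ.* + m)
  +N≡ = trans (ℤP.pos-* 2 (q * m)) (cong (+ 2 ℤ.*_) (ℤP.pos-* q m))
  a≐1/2m : A ℤ.* (+ 2 ℤ.* + m) ≡ + 1 ℤ.* Da
  a≐1/2m = trans (cong (A ℤ.*_) (sym (ℤP.pos-* 2 m))) (↥-/-cross (+ 1) (2 * m))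
  ringA : ∀ S Da Dx n → S ℤ.* n ℤ.* (Da ℤ.* Dx) ≡ (S ℤ.* (Da ℤ.* Dx)) ℤ.* n
  ringA = ℤSolver.solve-∀
  ringB : ∀ A Dx X Da Ds q m → (A ℤ.* Dx ℤ.+ X ℤ.* Da) ℤ.* Ds ℤ.* (+ 2 ℤ.* (q ℤ.* m))
          ≡ Ds ℤ.* (Dx ℤ.* q ℤ.* (A ℤ.* (+ 2 ℤ.* m)) ℤ.+ Da ℤ.* (X ℤ.* (+ 2 ℤ.* (q ℤ.* m))))
  ringB = ℤSolver.solve-∀
  ringC : ∀ Ds Dx q Da T → Ds ℤ.* (Dx ℤ.* q ℤ.* (+ 1 ℤ.* Da) ℤ.+ Da ℤ.* (T ℤ.* Dx)) ≡ (q ℤ.+ T) ℤ.* Ds ℤ.* (Da ℤ.* Dx)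
  ringC = ℤSolver.solve-∀

-- Σ_i 1 / (2 m_i), whose reduced denominator is bOf ms
∑inv2 : ∀ {r} → Vec ℕ r → ℚ
∑inv2 ms = foldr ℚ._+_ ℚ.0ℚ (List.map inv2 (toList ms))

Fraction-∑inv2 : ∀ {r} (ms : Vec ℕ r) n → .{{NonZero n}} → mOf ms ∣ n →
                 Fraction (∑inv2 ms) (quotientSum ms n) (2 * n)
Fraction-∑inv2 []       n _     = refl
Fraction-∑inv2 (zero ∷ ms) n lcm∣n =
  ⊥-elim (ℕ.≢-nonZero⁻¹ n (0∣⇒≡0 (∣-trans (m∣lcm[m,n] 0 (mOf ms)) lcm∣n)))
Fraction-∑inv2 (m@(suc m₀) ∷ ms) n lcm∣n with ∣-trans (m∣lcm[m,n] m (mOf ms)) lcm∣n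
... | divides q n≡qm =
  subst (λ t → Fraction (∑inv2 (m ∷ ms)) (t + quotientSum ms n) (2 * n)) (sym (÷-≡ n m q (trans (ℕP.*-comm m q) (sym n≡qm))))
    (subst (λ N → Fraction (∑inv2 (m ∷ ms)) (q + quotientSum ms n) (2 * N)) (sym n≡qm)
      (Fraction-inv2-+ m₀ q (∑inv2 ms) (quotientSum ms n)
        (subst (λ N → Fraction (∑inv2 ms) (quotientSum ms n) (2 * N)) n≡qm
          (Fraction-∑inv2 ms n (∣-trans (n∣lcm[m,n] m (mOf ms)) lcm∣n)))))

Fraction-denominator∣ : ∀ x n T → .{{NonZero n}} → Fraction x T (2 * n) → (↧ₙ x ∣ n → 2 ∣ T) × (2 ∣ T → ↧ₙ x ∣ n)
Fraction-denominator∣ (mkℚ num d coprime) n T x≐T/2n = to , from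
  where
  b = suc d
  to : b ∣ n → 2 ∣ T
  to (divides k n≡kb) = divides (ℤ.∣ num ∣ * k)
    (trans (cong ℤ.∣_∣ (trans (sym (ℤP.*-identityʳ (+ T))) T≡num*2k)) (trans (ℤP.abs-* num (+ (k * 2))) (sym (ℕP.*-assoc ℤ.∣ num ∣ k 2))))
    where
    T≡num*2k : + T ℤ.* + 1 ≡ num ℤ.* + (k * 2)
    T≡num*2k = ℤP.*-cancelʳ-≡ _ _ (+ b) (begin
      + T ℤ.* + 1 ℤ.* + b         ≡⟨ cong (ℤ._* + b) (ℤP.*-identityʳ (+ T)) ⟩
      + T ℤ.* + b                 ≡⟨ sym x≐T/2n ⟩
      num ℤ.* + (2 * n)           ≡⟨ cong (λ u → num ℤ.* + (2 * u)) n≡kb ⟩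
      num ℤ.* + (2 * (k * b))     ≡⟨ cong (λ u → num ℤ.* + u) (trans (sym (ℕP.*-assoc 2 k b)) (cong (_* b) (ℕP.*-comm 2 k))) ⟩
      num ℤ.* + (k * 2 * b)       ≡⟨ cong (num ℤ.*_) (ℤP.pos-* (k * 2) b) ⟩
      num ℤ.* (+ (k * 2) ℤ.* + b) ≡⟨ sym (ℤP.*-assoc num _ _) ⟩
      num ℤ.* + (k * 2) ℤ.* + b   ∎)
      where open ≡-Reasoning
  from : 2 ∣ T → b ∣ n
  from (divides t T≡t2) = coprime-divisor (coprime-sym (recompute coprime)) (divides t ∣num∣*n≡t*b)
    where
    num*n≡t*b : num ℤ.* + n ≡ + t ℤ.* + b
    num*n≡t*b = ℤP.*-cancelʳ-≡ _ _ (+ 2) (begin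
      num ℤ.* + n ℤ.* + 2       ≡⟨ ℤP.*-assoc num (+ n) (+ 2) ⟩
      num ℤ.* (+ n ℤ.* + 2)     ≡⟨ cong (num ℤ.*_) (trans (sym (ℤP.pos-* n 2)) (cong +_ (ℕP.*-comm n 2))) ⟩
      num ℤ.* + (2 * n)         ≡⟨ x≐T/2n ⟩
      + T ℤ.* + b               ≡⟨ cong (λ u → + u ℤ.* + b) T≡t2 ⟩
      + (t * 2) ℤ.* + b         ≡⟨ cong (ℤ._* + b) (ℤP.pos-* t 2) ⟩
      + t ℤ.* + 2 ℤ.* + b       ≡⟨ ℤP.*-assoc (+ t) (+ 2) (+ b) ⟩
      + t ℤ.* (+ 2 ℤ.* + b)     ≡⟨ cong (+ t ℤ.*_) (ℤP.*-comm (+ 2) (+ b)) ⟩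
      + t ℤ.* (+ b ℤ.* + 2)     ≡⟨ sym (ℤP.*-assoc (+ t) (+ b) (+ 2)) ⟩
      + t ℤ.* + b ℤ.* + 2       ∎)
      where open ≡-Reasoning
    ∣num∣*n≡t*b : ℤ.∣ num ∣ * n ≡ t * b
    ∣num∣*n≡t*b = trans (sym (ℤP.abs-* num (+ n))) (trans (cong ℤ.∣_∣ num*n≡t*b) (ℤP.abs-* (+ t) (+ b)))

-- Σ_i 1 / (2 m_i) = quotientSum ms d / (2 d), so b ∣ d iff that numerator is even.
m′∣⇔quotientSum-even : ∀ {r} (ms : Vec ℕ r) d → .{{NonZero d}} → mOf ms ∣ d → 2 ∣ d →
                      (m'Of ms ∣ d → 2 ∣ quotientSum ms d) × (2 ∣ quotientSum ms d → m'Of ms ∣ d)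
m′∣⇔quotientSum-even ms d m∣d 2∣d =
  (λ m′∣d → proj₁ b∣d⇔ (∣-trans (m∣lcm[m,n] (bOf ms) (mOf ms)) (∣-trans (n∣lcm[m,n] 2 _) m′∣d))) ,
  (λ even → lcm-least 2∣d (lcm-least (proj₂ b∣d⇔ even) m∣d))
  where
  b∣d⇔ = Fraction-denominator∣ (∑inv2 ms) d (quotientSum ms d) (Fraction-∑inv2 ms d m∣d)

m′∣⇒m∣ : ∀ {r} (ms : Vec ℕ r) d → m'Of ms ∣ d → mOf ms ∣ d
m′∣⇒m∣ ms d m′∣d = ∣-trans (n∣lcm[m,n] (bOf ms) (mOf ms)) (∣-trans (n∣lcm[m,n] 2 (lcm (bOf ms) (mOf ms))) m′∣d)

m′∣⇒2∣ : ∀ {r} (ms : Vec ℕ r) d → m'Of ms ∣ d → 2 ∣ d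
m′∣⇒2∣ ms d m′∣d = ∣-trans (m∣lcm[m,n] 2 (lcm (bOf ms) (mOf ms))) m′∣d

lcm-nonZero : ∀ m n → .{{NonZero m}} → .{{NonZero n}} → NonZero (lcm m n)
lcm-nonZero m n = ℕ.≢-nonZero λ lcm≡0 → ℕ.≢-nonZero⁻¹ (m * n) {{ℕP.m*n≢0 m n}}
  (trans (sym (gcd*lcm m n)) (trans (cong (gcd m n *_) lcm≡0) (ℕP.*-zeroʳ (gcd m n))))

mOf-nonZero : ∀ {r} (ms : Vec ℕ r) → (∀ i → NonZero (lookup ms i)) → NonZero (mOf ms)
mOf-nonZero []       _       = _
mOf-nonZero (m ∷ ms) nonZero = lcm-nonZero m (mOf ms) {{nonZero Fin.zero}} {{mOf-nonZero ms (nonZero ∘ Fin.suc)}}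

m'Of-nonZero : ∀ {r} (ms : Vec ℕ r) → (∀ i → NonZero (lookup ms i)) → NonZero (m'Of ms)
m'Of-nonZero ms nonZero = lcm-nonZero 2 _ {{_}} {{lcm-nonZero (bOf ms) (mOf ms) {{_}} {{mOf-nonZero ms nonZero}}}}

orderCount-lcm : ∀ {r} (ms : Vec ℕ r) n → orderCount ms n ≡ ℕΣ.when (does (mOf ms ∣? n)) (prodφ ms)
orderCount-lcm []       n = sym (cong (λ b → ℕΣ.when b 1) (dec-true (1 ∣? n) (1∣ n)))
orderCount-lcm (m ∷ ms) n = trans (cong (ℕΣ.when (does (m ∣? n)) (φ m) *_) (orderCount-lcm ms n))
                                  (when-lcm (m ∣? n) (mOf ms ∣? n) (mOf (m ∷ ms) ∣? n))
  where
  when-lcm : ∀ {L} (m∣n? : Dec (m ∣ n)) (L∣n? : Dec (L ∣ n)) (lcm∣n? : Dec (lcm m L ∣ n)) →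
             ℕΣ.when (does m∣n?) (φ m) * ℕΣ.when (does L∣n?) (prodφ ms) ≡ ℕΣ.when (does lcm∣n?) (φ m * prodφ ms)
  when-lcm (yes _)   (yes _)   (yes _)      = refl
  when-lcm (yes m∣n) (yes L∣n) (no lcm∤n)   = ⊥-elim (lcm∤n (lcm-least m∣n L∣n))
  when-lcm {L} (yes _) (no L∤n) (yes lcm∣n) = ⊥-elim (L∤n (∣-trans (n∣lcm[m,n] m L) lcm∣n))
  when-lcm (yes _)   (no _)    (no _)       = ℕP.*-zeroʳ (φ m)
  when-lcm {L} (no m∤n) _      (yes lcm∣n)  = ⊥-elim (m∤n (∣-trans (m∣lcm[m,n] m L) lcm∣n))
  when-lcm (no _)    _         (no _)       = refl

-- Assembling the count

-- the number of homomorphisms Γ → ℤ_n with the prescribed orders, for genus k + 1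
homCount : ∀ {r} → Vec ℕ r → ℕ → ℕ → ℕ
homCount ms k n = orderCount ms n * (n ^ k * halfCount n (quotientSum ms n))

oddPart : ∀ {r} → Vec ℕ r → ℕ → ℕ → ℕ → ℤ
oddPart ms k l d = when (not (does (2 ∣? d))) (when (does (mOf ms ∣? d)) (jordanTerm k l d))

evenPart : ∀ {r} → Vec ℕ r → ℕ → ℕ → ℕ → ℤ
evenPart ms k l d = when (does (m'Of ms ∣? d)) (jordanTerm k l d)

homCount-split : ∀ {r} (ms : Vec ℕ r) k d → .{{NonZero d}} → (c : ℤ) →
  c ℤ.* + homCount ms k d
  ≡ + prodφ ms ℤ.* (when (not (does (2 ∣? d))) (when (does (mOf ms ∣? d)) (c ℤ.* + (d ^ k)))
                    ℤ.+ + 2 ℤ.* when (does (m'Of ms ∣? d)) (c ℤ.* + (d ^ k)))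
homCount-split ms k d c =
  trans (cong (λ u → c ℤ.* + (u * (d ^ k * halfCount d (quotientSum ms d)))) (orderCount-lcm ms d))
        (cases (mOf ms ∣? d) (2 ∣? d) (m'Of ms ∣? d) (2 ∣? quotientSum ms d))
  where
  P = prodφ ms
  X = c ℤ.* + (d ^ k)
  +P*[a*b] : ∀ a b → + (P * (a * b)) ≡ + P ℤ.* (+ a ℤ.* + b)
  +P*[a*b] a b = trans (ℤP.pos-* P _) (cong (+ P ℤ.*_) (ℤP.pos-* a b))
  odd-case : ∀ c P dk → c ℤ.* (P ℤ.* (dk ℤ.* + 1)) ≡ P ℤ.* (c ℤ.* dk ℤ.+ + 2 ℤ.* + 0)
  odd-case = ℤSolver.solve-∀
  even-case : ∀ c P dk → c ℤ.* (P ℤ.* (dk ℤ.* + 2)) ≡ P ℤ.* (+ 0 ℤ.+ + 2 ℤ.* (c ℤ.* dk))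
  even-case = ℤSolver.solve-∀
  empty-case : ∀ c P dk → c ℤ.* (P ℤ.* (dk ℤ.* + 0)) ≡ P ℤ.* (+ 0 ℤ.+ + 2 ℤ.* + 0)
  empty-case = ℤSolver.solve-∀
  cases : (m∣d? : Dec (mOf ms ∣ d)) (2∣d? : Dec (2 ∣ d)) (m′∣d? : Dec (m'Of ms ∣ d)) (2∣T? : Dec (2 ∣ quotientSum ms d)) →
          c ℤ.* + (ℕΣ.when (does m∣d?) P * (d ^ k * halfCount′ 2∣d? 2∣T?))
          ≡ + P ℤ.* (when (not (does 2∣d?)) (when (does m∣d?) X) ℤ.+ + 2 ℤ.* when (does m′∣d?) X)
  cases (no m∤d) _ (yes m′∣d) _ = ⊥-elim (m∤d (m′∣⇒m∣ ms d m′∣d))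
  cases (no _) 2∣d? (no _) _ =
    trans (ℤP.*-zeroʳ c) (sym (trans (cong (λ u → + P ℤ.* (u ℤ.+ + 0)) (ℤΣ.when-ε (not (does 2∣d?)))) (ℤP.*-zeroʳ (+ P))))
  cases (yes _) (no 2∤d) (yes m′∣d) _ = ⊥-elim (2∤d (m′∣⇒2∣ ms d m′∣d))
  cases (yes _) (no _) (no _) _ = trans (cong (c ℤ.*_) (+P*[a*b] (d ^ k) 1)) (odd-case c (+ P) (+ (d ^ k)))
  cases (yes m∣d) (yes 2∣d) (yes _) (yes _) = trans (cong (c ℤ.*_) (+P*[a*b] (d ^ k) 2)) (even-case c (+ P) (+ (d ^ k)))
  cases (yes m∣d) (yes 2∣d) (no m′∤d) (yes even) = ⊥-elim (m′∤d (proj₂ (m′∣⇔quotientSum-even ms d m∣d 2∣d) even))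
  cases (yes m∣d) (yes 2∣d) (yes m′∣d) (no odd) = ⊥-elim (odd (proj₁ (m′∣⇔quotientSum-even ms d m∣d 2∣d) m′∣d))
  cases (yes m∣d) (yes 2∣d) (no _) (no _) = trans (cong (c ℤ.*_) (+P*[a*b] (d ^ k) 0)) (empty-case c (+ P) (+ (d ^ k)))

EpiO′-split : ∀ {r} k (ms : Vec ℕ r) l .{{_ : NonZero l}} →
  + EpiO' l {g = suc k} ms
  ≡ + prodφ ms ℤ.* (divisorSum (suc l) l (oddPart ms k l) ℤ.+ + 2 ℤ.* divisorSum (suc l) l (evenPart ms k l))
EpiO′-split {r} k ms l = begin
  + EpiO' l {g = suc k} ms
    ≡⟨ EpiO′-möbius l (suc k) ms ⟩
  divisorSum (suc l) l (λ x → μ x ℤ.* + homsInto l (suc k) ms x)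
    ≡⟨ divisorSum-cong (suc l) l _ _ (λ x x∣l → cong (λ u → μ x ℤ.* + u) (homsInto-by-cofactor x x∣l)) ⟩
  divisorSum (suc l) l (λ x → μ x ℤ.* + homCount ms k (l ÷ x))
    ≡⟨ divisorSum-complement l (suc l) (λ x → μ x ℤ.* + homCount ms k (l ÷ x)) ℕP.≤-refl ⟩
  divisorSum (suc l) l (λ d → μ (l ÷ d) ℤ.* + homCount ms k (l ÷ (l ÷ d)))
    ≡⟨ divisorSum-cong (suc l) l _ _ (λ d d∣l → trans (cong (λ u → μ (l ÷ d) ℤ.* + homCount ms k u) (l÷[l÷d]≡d d d∣l))
                                                       (homCount-split ms k d {{divisor-nonZero d∣l}} (μ (l ÷ d)))) ⟩
  divisorSum (suc l) l (λ d → + prodφ ms ℤ.* (oddPart ms k l d ℤ.+ + 2 ℤ.* evenPart ms k l d))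
    ≡⟨ divisorSum-linear (suc l) l (+ prodφ ms) (+ 2) (oddPart ms k l) (evenPart ms k l) ⟩
  + prodφ ms ℤ.* (divisorSum (suc l) l (oddPart ms k l) ℤ.+ + 2 ℤ.* divisorSum (suc l) l (evenPart ms k l)) ∎
  where
  open ≡-Reasoning
  divisor-nonZero : ∀ {d} → d ∣ l → NonZero d
  divisor-nonZero d∣l = ℕ.≢-nonZero λ { refl → ℕ.≢-nonZero⁻¹ l (0∣⇒≡0 d∣l) }
  cofactor-nonZero : ∀ {d q} → l ≡ q * d → NonZero q
  cofactor-nonZero {d} l≡qd = ℕ.≢-nonZero λ { refl → ℕ.≢-nonZero⁻¹ l l≡qd }
  homsInto-by-cofactor : ∀ x → x ∣ l → homsInto l (suc k) ms x ≡ homCount ms k (l ÷ x)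
  homsInto-by-cofactor x x∣l@(divides q l≡qx) = trans
    (homsInto-count l x q {{_}} {{divisor-nonZero x∣l}} {{cofactor-nonZero l≡qx}} xq≡l k ms)
    (cong (homCount ms k) (sym (÷-≡ l x q xq≡l {{divisor-nonZero x∣l}})))
    where
    xq≡l : x * q ≡ l
    xq≡l = trans (ℕP.*-comm x q) (sym l≡qx)
  l÷[l÷d]≡d : ∀ d → d ∣ l → l ÷ (l ÷ d) ≡ d
  l÷[l÷d]≡d d d∣l@(divides q l≡qd) =
    trans (cong (l ÷_) (÷-≡ l d q (trans (ℕP.*-comm d q) (sym l≡qd)) {{divisor-nonZero d∣l}}))
          (÷-≡ l q d (sym l≡qd) {{cofactor-nonZero l≡qd}})

odd⇒nonZero : ∀ {n} → ¬ 2 ∣ n → NonZero n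
odd⇒nonZero {zero}  2∤0 = ⊥-elim (2∤0 (2 ∣0))
odd⇒nonZero {suc _} _   = _

odd-cofactor : ∀ {d x} → ¬ 2 ∣ d → 2 ∣ x * d → 2 ∣ x
odd-cofactor {d} {x} 2∤d 2∣xd with euclidsLemma x d prime[2] 2∣xd
... | inj₁ 2∣x = 2∣x
... | inj₂ 2∣d = ⊥-elim (2∤d 2∣d)

4∣⇒μ[÷odd]≡0 : ∀ {l d} → .{{NonZero l}} → 2 * 2 ∣ l → d ∣ l → ¬ 2 ∣ d → μ (l ÷ d) ≡ + 0
4∣⇒μ[÷odd]≡0 {l} {d} 4∣l (divides c l≡cd) 2∤d = trans (cong μ l÷d≡c) (μ-square prime[2] {{c-nonZero}} 4∣c)
  where
  c-nonZero : NonZero c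
  c-nonZero = ℕ.≢-nonZero λ { refl → ℕ.≢-nonZero⁻¹ l l≡cd }
  l÷d≡c : l ÷ d ≡ c
  l÷d≡c = ÷-≡ l d c (trans (ℕP.*-comm d c) (sym l≡cd)) {{ℕ.≢-nonZero λ { refl → ℕ.≢-nonZero⁻¹ l (trans l≡cd (ℕP.*-zeroʳ c)) }}}
  4∣cd : 2 * 2 ∣ c * d
  4∣cd = subst (2 * 2 ∣_) l≡cd 4∣l
  4∣c : 2 * 2 ∣ c
  4∣c with odd-cofactor 2∤d (∣-trans (m∣m*n 2) 4∣cd)
  ... | divides c₁ c≡c₁2 = subst (2 * 2 ∣_) (sym c≡c₁2) (*-monoˡ-∣ 2 2∣c₁)
    where
    c₁d2≡ : c * d ≡ c₁ * d * 2
    c₁d2≡ = trans (cong (_* d) c≡c₁2) (trans (ℕP.*-assoc c₁ 2 d) (trans (cong (c₁ *_) (ℕP.*-comm 2 d)) (sym (ℕP.*-assoc c₁ d 2))))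
    2∣c₁ : 2 ∣ c₁
    2∣c₁ = odd-cofactor 2∤d (*-cancelʳ-∣ 2 (subst (2 * 2 ∣_) c₁d2≡ 4∣cd))

jordanTerm-2* : ∀ k n d → ¬ 2 ∣ n → d ∣ n → jordanTerm k (2 * n) d ≡ ℤ.- jordanTerm k n d
jordanTerm-2* k n d 2∤n d∣n@(divides c n≡cd) = begin
  μ (2 * n ÷ d) ℤ.* + (d ^ k)  ≡⟨ cong (λ u → μ u ℤ.* + (d ^ k)) 2n÷d≡2c ⟩
  μ (2 * c) ℤ.* + (d ^ k)      ≡⟨ cong (ℤ._* + (d ^ k)) (μ-*-prime prime[2] 2∤c {{c-nonZero}}) ⟩
  ℤ.- μ c ℤ.* + (d ^ k)        ≡⟨ sym (ℤP.neg-distribˡ-* (μ c) _) ⟩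
  ℤ.- (μ c ℤ.* + (d ^ k))      ≡⟨ cong (λ u → ℤ.- (μ u ℤ.* + (d ^ k))) (sym n÷d≡c) ⟩
  ℤ.- jordanTerm k n d         ∎
  where
  open ≡-Reasoning
  n-nonZero : NonZero n
  n-nonZero = ℕ.≢-nonZero λ { refl → 2∤n (2 ∣0) }
  instance _ = ℕ.≢-nonZero λ { refl → ℕ.≢-nonZero⁻¹ n {{n-nonZero}} (trans n≡cd (ℕP.*-zeroʳ c)) }
  c-nonZero : NonZero c
  c-nonZero = ℕ.≢-nonZero λ { refl → ℕ.≢-nonZero⁻¹ n {{n-nonZero}} n≡cd }
  2∤c : ¬ 2 ∣ c
  2∤c 2∣c = 2∤n (∣-trans 2∣c (divides d (trans n≡cd (ℕP.*-comm c d))))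
  2n÷d≡2c : 2 * n ÷ d ≡ 2 * c
  2n÷d≡2c = ÷-≡ (2 * n) d (2 * c) (trans (ℕP.*-comm d (2 * c)) (trans (ℕP.*-assoc 2 c d) (cong (2 *_) (sym n≡cd))))
  n÷d≡c : n ÷ d ≡ c
  n÷d≡c = ÷-≡ n d c (trans (ℕP.*-comm d c) (sym n≡cd))

-- The odd divisors of 2 n (n odd) are the divisors of n, and μ (2 n / d) = - μ (n / d).
divisorSum-oddPart-2* : ∀ {r} (ms : Vec ℕ r) k n → .{{NonZero (mOf ms)}} → ¬ 2 ∣ n →
  divisorSum (suc (2 * n)) (2 * n) (oddPart ms k (2 * n)) ≡ ℤ.- (+ (mOf ms ^ k) ℤ.* Jfrac k (2 * n) (2 * mOf ms))
divisorSum-oddPart-2* ms k n 2∤n = begin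
  divisorSum (suc (2 * n)) (2 * n) (oddPart ms k (2 * n))
    ≡⟨ ℤΣ.∑-cong (suc (2 * n)) (λ d _ → odd-divisor d (d ∣? 2 * n) (2 ∣? d) (d ∣? n)) ⟩
  ℤΣ.∑ (suc (2 * n)) (λ d → ℤ.- when (does (d ∣? n)) (G d))
    ≡⟨ ℤ∑-neg (suc (2 * n)) (λ d → when (does (d ∣? n)) (G d)) ⟩
  ℤ.- divisorSum (suc (2 * n)) n G
    ≡⟨ cong ℤ.-_ (divisorSum-extend n (suc (2 * n)) G (s≤s (ℕP.m≤n*m n 2))) ⟩
  ℤ.- divisorSum (suc n) n G
    ≡⟨ cong ℤ.-_ (divisorSum-multiples-Jordan k n (mOf ms)) ⟩
  ℤ.- (+ (mOf ms ^ k) ℤ.* Jfrac k n (mOf ms))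
    ≡⟨ cong (λ u → ℤ.- (+ (mOf ms ^ k) ℤ.* u)) (sym (Jfrac-double k n (mOf ms))) ⟩
  ℤ.- (+ (mOf ms ^ k) ℤ.* Jfrac k (2 * n) (2 * mOf ms)) ∎
  where
  open ≡-Reasoning
  instance _ = ℕ.≢-nonZero λ { refl → 2∤n (2 ∣0) }
  G = λ d → when (does (mOf ms ∣? d)) (jordanTerm k n d)
  odd-divisor : ∀ d (d∣2n? : Dec (d ∣ 2 * n)) (2∣d? : Dec (2 ∣ d)) (d∣n? : Dec (d ∣ n)) →
                when (does d∣2n?) (when (not (does 2∣d?)) (when (does (mOf ms ∣? d)) (jordanTerm k (2 * n) d)))
                ≡ ℤ.- when (does d∣n?) (G d)
  odd-divisor d (yes _)     (yes 2∣d) (yes d∣n) = ⊥-elim (2∤n (∣-trans 2∣d d∣n))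
  odd-divisor d (yes _)     (no _)    (yes d∣n) =
    trans (cong (when (does (mOf ms ∣? d))) (jordanTerm-2* k n d 2∤n d∣n))
          (when-neg (does (mOf ms ∣? d)) (jordanTerm k n d))
  odd-divisor d (no d∤2n)   _         (yes d∣n) = ⊥-elim (d∤2n (∣n⇒∣m*n 2 d∣n))
  odd-divisor d (yes _)     (yes _)   (no _)    = refl
  odd-divisor d (yes d∣2n)  (no 2∤d)  (no d∤n)  = ⊥-elim (d∤n (coprime-divisor (prime∤⇒coprime prime[2] 2∤d) d∣2n))
  odd-divisor d (no _)      _         (no _)    = refl

module _ {r} (k : ℕ) (ms : Vec ℕ r) .{{_ : NonZero (mOf ms)}} .{{_ : NonZero (m'Of ms)}} where

  private
    m  = mOf ms
    m′ = m'Of ms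
    P  = prodφ ms

  EpiO-odd : ∀ l → ¬ 2 ∣ l → + EpiO (suc k) ms l ≡ + (m ^ k) ℤ.* Jfrac k l m ℤ.* + P
  EpiO-odd zero        2∤0 = ⊥-elim (2∤0 (2 ∣0))
  EpiO-odd l@(suc _)   2∤l = begin
    + EpiO' l {g = suc k} ms
      ≡⟨ EpiO′-split k ms l ⟩
    + P ℤ.* (divisorSum (suc l) l (oddPart ms k l) ℤ.+ + 2 ℤ.* divisorSum (suc l) l (evenPart ms k l))
      ≡⟨ cong₂ (λ u v → + P ℤ.* (u ℤ.+ + 2 ℤ.* v)) odd-divisors no-even-divisors ⟩
    + P ℤ.* (+ (m ^ k) ℤ.* Jfrac k l m ℤ.+ + 2 ℤ.* + 0)
      ≡⟨ rearrange (+ P) (+ (m ^ k)) (Jfrac k l m) ⟩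
    + (m ^ k) ℤ.* Jfrac k l m ℤ.* + P ∎
    where
    open ≡-Reasoning
    odd-divisors : divisorSum (suc l) l (oddPart ms k l) ≡ + (m ^ k) ℤ.* Jfrac k l m
    odd-divisors = trans (divisorSum-cong (suc l) l _ _ (λ d d∣l →
                            cong (λ b → when (not b) (when (does (m ∣? d)) (jordanTerm k l d)))
                                 (dec-false (2 ∣? d) (λ 2∣d → 2∤l (∣-trans 2∣d d∣l)))))
                         (divisorSum-multiples-Jordan k l m)
    no-even-divisors : divisorSum (suc l) l (evenPart ms k l) ≡ + 0
    no-even-divisors = divisorSum-zero (suc l) l _ (λ d d∣l →
      cong (λ b → when b (jordanTerm k l d)) (dec-false (m′ ∣? d) (λ m′∣d → 2∤l (∣-trans (m′∣⇒2∣ ms d m′∣d) d∣l))))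
    rearrange : ∀ P M J → P ℤ.* (M ℤ.* J ℤ.+ + 2 ℤ.* + 0) ≡ M ℤ.* J ℤ.* P
    rearrange = ℤSolver.solve-∀

  EpiO-2^q : ∀ l q n → ¬ 2 ∣ n → 1 < q → l ≡ 2 ^ q * n →
             + EpiO (suc k) ms l ≡ + 2 ℤ.* + (m′ ^ k) ℤ.* Jfrac k l m′ ℤ.* + P
  EpiO-2^q zero q n 2∤n _ 0≡2^qn =
    ⊥-elim (ℕ.≢-nonZero⁻¹ (2 ^ q * n) {{ℕP.m*n≢0 (2 ^ q) n {{ℕP.m^n≢0 2 q}} {{odd⇒nonZero 2∤n}}}} (sym 0≡2^qn))
  EpiO-2^q (suc _) 0             _ _ ()          _
  EpiO-2^q (suc _) 1             _ _ (s≤s ())   _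
  EpiO-2^q l@(suc _) (suc (suc q)) n _ _ l≡2^qn = begin
    + EpiO' l {g = suc k} ms
      ≡⟨ EpiO′-split k ms l ⟩
    + P ℤ.* (divisorSum (suc l) l (oddPart ms k l) ℤ.+ + 2 ℤ.* divisorSum (suc l) l (evenPart ms k l))
      ≡⟨ cong₂ (λ u v → + P ℤ.* (u ℤ.+ + 2 ℤ.* v)) odd-divisors (divisorSum-multiples-Jordan k l m′) ⟩
    + P ℤ.* (+ 0 ℤ.+ + 2 ℤ.* (+ (m′ ^ k) ℤ.* Jfrac k l m′))
      ≡⟨ rearrange (+ P) (+ (m′ ^ k)) (Jfrac k l m′) ⟩
    + 2 ℤ.* + (m′ ^ k) ℤ.* Jfrac k l m′ ℤ.* + P ∎
    where
    open ≡-Reasoning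
    4∣l : 2 * 2 ∣ l
    4∣l = subst (2 * 2 ∣_) (sym l≡2^qn) (∣m⇒∣m*n {2 * 2} {2 * (2 * 2 ^ q)} n (*-monoʳ-∣ 2 (m∣m*n {2} (2 ^ q))))
    odd-divisor : ∀ d → d ∣ l → (2∣d? : Dec (2 ∣ d)) → when (not (does 2∣d?)) (when (does (m ∣? d)) (jordanTerm k l d)) ≡ + 0
    odd-divisor d d∣l (yes _)  = refl
    odd-divisor d d∣l (no 2∤d) = trans (cong (λ u → when (does (m ∣? d)) (u ℤ.* + (d ^ k))) (4∣⇒μ[÷odd]≡0 4∣l d∣l 2∤d))
                                       (ℤΣ.when-ε (does (m ∣? d)))
    odd-divisors : divisorSum (suc l) l (oddPart ms k l) ≡ + 0
    odd-divisors = divisorSum-zero (suc l) l _ (λ d d∣l → odd-divisor d d∣l (2 ∣? d))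
    rearrange : ∀ P M J → P ℤ.* (+ 0 ℤ.+ + 2 ℤ.* (M ℤ.* J)) ≡ + 2 ℤ.* M ℤ.* J ℤ.* P
    rearrange = ℤSolver.solve-∀

  EpiO-2*odd : ∀ l n → ¬ 2 ∣ n → l ≡ 2 * n →
    + EpiO (suc k) ms l ≡ (+ 2 ℤ.* + (m′ ^ k) ℤ.* Jfrac k l m′ ℤ.* + P) ℤ.- (+ (m ^ k) ℤ.* Jfrac k l (2 * m) ℤ.* + P)
  EpiO-2*odd _ zero      2∤0 _    = ⊥-elim (2∤0 (2 ∣0))
  EpiO-2*odd _ n@(suc _) 2∤n refl = begin
    + EpiO' (2 * n) {g = suc k} ms
      ≡⟨ EpiO′-split k ms (2 * n) ⟩
    + P ℤ.* (divisorSum (suc (2 * n)) (2 * n) (oddPart ms k (2 * n)) ℤ.+ + 2 ℤ.* divisorSum (suc (2 * n)) (2 * n) (evenPart ms k (2 * n)))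
      ≡⟨ cong₂ (λ u v → + P ℤ.* (u ℤ.+ + 2 ℤ.* v)) (divisorSum-oddPart-2* ms k n 2∤n) (divisorSum-multiples-Jordan k (2 * n) m′) ⟩
    + P ℤ.* (ℤ.- (+ (m ^ k) ℤ.* Jfrac k (2 * n) (2 * m)) ℤ.+ + 2 ℤ.* (+ (m′ ^ k) ℤ.* Jfrac k (2 * n) m′))
      ≡⟨ rearrange (+ P) (+ (m ^ k)) (Jfrac k (2 * n) (2 * m)) (+ (m′ ^ k)) (Jfrac k (2 * n) m′) ⟩
    (+ 2 ℤ.* + (m′ ^ k) ℤ.* Jfrac k (2 * n) m′ ℤ.* + P) ℤ.- (+ (m ^ k) ℤ.* Jfrac k (2 * n) (2 * m) ℤ.* + P) ∎
    where
    open ≡-Reasoning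
    rearrange : ∀ P M J M′ J′ → P ℤ.* (ℤ.- (M ℤ.* J) ℤ.+ + 2 ℤ.* (M′ ℤ.* J′)) ≡ (+ 2 ℤ.* M′ ℤ.* J′ ℤ.* P) ℤ.- (M ℤ.* J ℤ.* P)
    rearrange = ℤSolver.solve-∀

corollary2 : (g r : ℕ) → 1 ≤ g → (ms : Vec ℕ r)
  → (∀ (i : Fin r) → 1 < lookup ms i)
  → (∀ (i j : Fin r) → i Fin.≤ j → lookup ms i ≤ lookup ms j)
  → (l : ℕ)
  → ((¬ (2 ∣ l)
       → + EpiO g ms l
         ≡ + (mOf ms ^ (g ∸ 1)) ℤ.* Jfrac (g ∸ 1) l (mOf ms) ℤ.* + prodφ ms)
   × (∀ (q k : ℕ) → ¬ (2 ∣ k) → 1 < q → l ≡ 2 ^ q * k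
       → + EpiO g ms l
         ≡ + 2 ℤ.* + (m'Of ms ^ (g ∸ 1)) ℤ.* Jfrac (g ∸ 1) l (m'Of ms) ℤ.* + prodφ ms)
   × (∀ (k : ℕ) → ¬ (2 ∣ k) → l ≡ 2 * k
       → + EpiO g ms l
         ≡ (+ 2 ℤ.* + (m'Of ms ^ (g ∸ 1)) ℤ.* Jfrac (g ∸ 1) l (m'Of ms) ℤ.* + prodφ ms)
           ℤ.- (+ (mOf ms ^ (g ∸ 1)) ℤ.* Jfrac (g ∸ 1) l (2 * mOf ms) ℤ.* + prodφ ms)))
-- The periods need not be sorted, and m_i > 1 is only used as m_i ≠ 0.
corollary2 (suc g′) r _ ms periods>1 _ l = EpiO-odd g′ ms l , EpiO-2^q g′ ms l , EpiO-2*odd g′ ms l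
  where
  periods≢0 : ∀ i → NonZero (lookup ms i)
  periods≢0 i = ℕ.>-nonZero (ℕP.<-trans (s≤s z≤n) (periods>1 i))
  instance
    _ = mOf-nonZero ms periods≢0
    _ = m'Of-nonZero ms periods≢0
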